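{- Let $\ell,\beta$ be positive integers and $k<\ell$ a nonnegative integer. Let $A$ be a $k$-dimensional linear subset of $\mathbb{N}^\ell$ and $B=\Psi^{ -1}(A)\cap\mathcal{B}_\ell$. If $\Psi(f_{\beta^\ell}(B))$ contains a sequence $x^{(n)}=(x^{(n)}_1,\ldots,x^{(n)}_\ell)$ such that $\min(x^{(n)}_{j_1},x^{(n)}_{j_2},\ldots,x^{(n)}_{j_{k+1}})\to\infty$ as $n\to\infty$ for some indices $j_1<j_2<\cdots<j_{k+1}$, then $f_{\beta^\ell}(B)$ is not regular.
   Context: Let $\Sigma_\ell=\{a_1<\cdots<a_\ell\}$ and $\mathcal{B}_\ell=a_1^*\cdots a_\ell^*$; $\mathrm{rep}_\ell(n)$ is the $(n+1)$-st word of $\mathcal{B}_\ell$ in genealogical order (shorter words first; equal-length words ordered lexicographically), and $\mathrm{val}_\ell=\mathrm{rep}_\ell^{ -1}$. For $\lambda\in\mathbb{N}$, $f_\lambda:\mathcal{B}_\ell\to\mathcal{B}_\ell$ is $f_\lambda(w)=\mathrm{rep}_\ell(\lambda\,\mathrm{val}_\ell(w))$. The Parikh map is $\Psi(w)=(|w|_{a_1},\ldots,|w|_{a_\ell})$. A set $Z\subseteq\mathbb{N}^\ell$ is linear if $Z=\mathbf{p}_0+\mathbb{N}\mathbf{p}_1+\cdots+\mathbb{N}\mathbf{p}_m$ for some vectors $\mathbf{p}_i\in\mathbb{N}^\ell$ (the periods); it is $k$-dimensional if it has exactly $k$ periods that are linearly independent over $\mathbb{Q}$ (i.e., its periods span a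 $k$-dimensional space). -}

module Defs where

open import Data.Nat using (ℕ; zero; suc; _+_; _*_; _≤_; _<_)
open import Data.Nat as ℕ using ()
open import Data.Bool using (Bool; T; T?; true; false; _∧_; _∨_; if_then_else_)
open import Data.Fin using (Fin; toℕ)
open import Data.List using (List; []; _∷_; length; map; concatMap; filter; upTo; allFin; foldl)
open import Data.Product using (Σ; ∃; _×_; _,_)
open import Data.Rational using (ℚ; 0ℚ; _+_; _*_) renaming (_/_ to _/ℚ_)
open import Data.Rational as Q using ()
open import Data.Integer as Z using ()
open import Relation.Binary.PropositionalEquality using (_≡_)
open import Relation.Nullary using (¬_)
open import Relation.Nullary.Decidable using (⌊_⌋)
open import Function.Bundles using (_⇔_)

-- Words over Σ_ℓ = {a_1 < ... < a_ℓ} are lists of letters Fin ℓ,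
-- the letter order being the usual order on Fin ℓ.
Word : ℕ → Set
Word ℓ = List (Fin ℓ)

_≤ᶠ_ : ∀ {ℓ} → Fin ℓ → Fin ℓ → Bool
a ≤ᶠ b = ⌊ toℕ a ℕ.≤? toℕ b ⌋

_<ᶠ_ : ∀ {ℓ} → Fin ℓ → Fin ℓ → Bool
a <ᶠ b = ⌊ toℕ a ℕ.<? toℕ b ⌋

_≡ᶠ_ : ∀ {ℓ} → Fin ℓ → Fin ℓ → Bool
a ≡ᶠ b = ⌊ toℕ a ℕ.≟ toℕ b ⌋

-- w ∈ B_ℓ = a_1^* ⋯ a_ℓ^*  iff the letters of w are non-decreasing
sortedᵇ : ∀ {ℓ} → Word ℓ → Bool
sortedᵇ [] = true
sortedᵇ (a ∷ []) = true
sortedᵇ (a ∷ b ∷ w) = (a ≤ᶠ b) ∧ sortedᵇ (b ∷ w)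

InB : ∀ {ℓ} → Word ℓ → Set
InB w = sortedᵇ w ≡ true

lexLtᵇ : ∀ {ℓ} → Word ℓ → Word ℓ → Bool
lexLtᵇ [] [] = false
lexLtᵇ [] (_ ∷ _) = true
lexLtᵇ (_ ∷ _) [] = false
lexLtᵇ (a ∷ u) (b ∷ v) = (a <ᶠ b) ∨ ((a ≡ᶠ b) ∧ lexLtᵇ u v)

genLtᵇ : ∀ {ℓ} → Word ℓ → Word ℓ → Bool
genLtᵇ u v = ⌊ length u ℕ.<? length v ⌋
           ∨ (⌊ length u ℕ.≟ length v ⌋ ∧ lexLtᵇ u v)

wordsOfLength : ∀ ℓ → ℕ → List (Word ℓ)
wordsOfLength ℓ zero = [] ∷ []
wordsOfLength ℓ (suc n) =
  concatMap (λ w → map (λ a → a ∷ w) (allFin ℓ)) (wordsOfLength ℓ n)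

wordsUpTo : ∀ ℓ → ℕ → List (Word ℓ)
wordsUpTo ℓ n = concatMap (wordsOfLength ℓ) (upTo (suc n))

-- val_ℓ(w): the position (from 0) of w in B_ℓ in genealogical order,
-- i.e. the number of words of B_ℓ genealogically smaller than w.
val : ∀ {ℓ} → Word ℓ → ℕ
val {ℓ} w = length (filter (λ u → T? (sortedᵇ u ∧ genLtᵇ u w))
                           (wordsUpTo ℓ (length w)))

-- rep_ℓ(n) is the unique w ∈ B_ℓ with val_ℓ(w) = n
IsRep : ∀ {ℓ} → ℕ → Word ℓ → Set
IsRep n w = InB w × val w ≡ n

countLetter : ∀ {ℓ} → Fin ℓ → Word ℓ → ℕ
countLetter a [] = 0
countLetter a (b ∷ w) = (if a ≡ᶠ b then 1 else 0) ℕ.+ countLetter a w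

Ψ : ∀ {ℓ} → Word ℓ → (Fin ℓ → ℕ)
Ψ w a = countLetter a w

sumℕ : ∀ {m} → (Fin m → ℕ) → ℕ
sumℕ {zero} f = 0
sumℕ {suc m} f = f Fin.zero ℕ.+ sumℕ (λ i → f (Fin.suc i))
  where import Data.Fin as Fin

sumℚ : ∀ {m} → (Fin m → ℚ) → ℚ
sumℚ {zero} f = 0ℚ
sumℚ {suc m} f = f Fin.zero Q.+ sumℚ (λ i → f (Fin.suc i))
  where import Data.Fin as Fin

InLinear : ∀ {ℓ m} → (Fin ℓ → ℕ) → (Fin m → Fin ℓ → ℕ) → (Fin ℓ → ℕ) → Set
InLinear {ℓ} {m} p0 p x =
  Σ (Fin m → ℕ) λ c → ∀ j → x j ≡ p0 j ℕ.+ sumℕ (λ i → c i ℕ.* p i j)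

LinIndep : ∀ {ℓ r} → (Fin r → Fin ℓ → ℕ) → Set
LinIndep {ℓ} {r} v =
  (c : Fin r → ℚ) →
  (∀ j → sumℚ (λ i → c i Q.* (Z.+ (v i j) Q./ 1)) ≡ 0ℚ) →
  ∀ i → c i ≡ 0ℚ

InjectiveFin : ∀ {a b} → (Fin a → Fin b) → Set
InjectiveFin s = ∀ x y → s x ≡ s y → x ≡ y

-- the periods span a k-dimensional ℚ-space: some k of them are linearly
-- independent, and no k+1 (distinct) of them are.
Rank : ∀ {ℓ m} → (Fin m → Fin ℓ → ℕ) → ℕ → Set
Rank {ℓ} {m} p k =
  (Σ (Fin k → Fin m) λ s → InjectiveFin s × LinIndep (λ i → p (s i)))
  × (∀ (t : Fin (suc k) → Fin m) → InjectiveFin t → ¬ LinIndep (λ i → p (t i)))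

record DFA (ℓ : ℕ) : Set where
  field
    nStates : ℕ
    start   : Fin nStates
    δ       : Fin nStates → Fin ℓ → Fin nStates
    final   : Fin nStates → Bool

accepts : ∀ {ℓ} → DFA ℓ → Word ℓ → Bool
accepts D w = DFA.final D (foldl (DFA.δ D) (DFA.start D) w)

Regular : ∀ {ℓ} → (Word ℓ → Set) → Set
Regular {ℓ} L = Σ (DFA ℓ) λ D → ∀ w → L w ⇔ (accepts D w ≡ true)

-- f_λ(B) for B = Ψ^{-1}(A) ∩ B_ℓ, A = p0 + ℕ p_1 + ⋯ + ℕ p_m :
-- w ∈ f_λ(B) iff w = rep_ℓ(λ · val_ℓ(u)) for some u ∈ B
fImage : ∀ {ℓ m} → ℕ → (Fin ℓ → ℕ) → (Fin m → Fin ℓ → ℕ) → Word ℓ → Set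
fImage {ℓ} lam p0 p w =
  Σ (Word ℓ) λ u → (InB u × InLinear p0 p (Ψ u)) × IsRep (lam ℕ.* val u) w

module Submission where

-- Suppose a DFA with Q states recognises L = f_λ(B) where
-- λ = β^ℓ ≥ 1 (only λ ≥ 1 is used).
-- (1) Linear algebra.  Fix k independent periods b_1,…,b_k.  As no k+1
--     periods are independent, every period p_j satisfies a relation
--     D·p_j + Σ_i N⁻_ji b_i = Σ_i N⁺_ji b_i over ℕ with one common D ≥ 1.
--     These relations exist only classically (under ¬¬), which is harmless
--     because the goal is ⊥.
-- (2) Pumping.  Take w ∈ L with |w|_{a_{j_i}} ≥ Q for the k+1 given letters.
--     Adding t_i·Q! letters a_{j_i} to the sorted word w does not change the
--     run of the DFA, so every pumped word v_t is in L: v_t = f_λ(u_t), u_t ∈ B.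
-- (3) Counting.  val and Ψ are injective on B, so t ↦ u_t is injective, and
--     by (1) D·Ψ(u_t) = D·p0 + Σ_i (P_i − N_i)·b_i with P, N bounded linearly
--     in |v_t| ≥ |u_t|.  For t ∈ [0,T)^{k+1} this injects T^{k+1} points into
--     (C·T)^k codes, which fails for T = C^k + 1.
-- The file develops, in order: finite sums; Parikh vectors of sorted words;
-- pumping in a DFA; injectivity of val on B; rational dependencies turned
-- into natural-number relations; counting injections; the argument itself.

open import Defs
open import Data.Nat as ℕ
  using (ℕ; zero; suc; _+_; _*_; _∸_; _^_; _≤_; _<_; z≤n; s≤s; _!; _≤?_; _<?_)
open import Data.Nat.Properties
open import Data.Nat.Divisibility using (_∣_; divides; ∣-trans; m≤n⇒m!∣n!)
open import Data.Nat.Tactic.RingSolver using (solve-∀)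
open import Data.Integer as ℤ using (ℤ)
import Data.Integer.Properties as ℤP
import Data.Integer.Tactic.RingSolver as ℤSolver
open import Data.Rational as ℚ using (ℚ; mkℚ; 0ℚ; ↥_; ↧ₙ_)
import Data.Rational.Properties as ℚP
open import Data.Rational.Unnormalised using (*≡*)
open import Data.Rational.Unnormalised.Properties using (≃-trans; ≃-sym)
open import Data.Nat.Coprimality using (1-coprimeTo) renaming (sym to coprime-sym)
open import Data.Bool using (Bool; true; false; _∧_; _∨_; T?; if_then_else_)
open import Data.Bool.Properties using (∧-zeroʳ)
open import Data.Fin as Fin
  using (Fin; toℕ; fromℕ<; funToFin; finToFun) renaming (zero to fz; suc to fs; _<_ to _<F_)
open import Data.Fin.Properties
  using (toℕ-injective; toℕ<n; toℕ-fromℕ<; pigeonhole; any?; injective⇒≤; finToFun-funToFin; funToFin-finToFin)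
  renaming (_≟_ to _≟F_; suc-injective to fs-injective)
open import Data.List
  using (List; []; _∷_; _++_; length; map; concatMap; replicate; tabulate; allFin; filter; upTo; foldl; [_])
open import Data.List.Properties
  using (length-++; filter-++; applyUpTo-∷ʳ; concatMap-++; ++-identityʳ; foldl-++; length-replicate)
open import Data.List.Relation.Unary.All as All using (All; []; _∷_)
open import Data.List.Relation.Unary.All.Properties using (++⁺; concat⁺; map⁺)
open import Data.List.Relation.Unary.AllPairs using (AllPairs; []; _∷_)
open import Data.List.Relation.Unary.Any using (here; there)
open import Data.List.Membership.Propositional using (_∈_; lose)
open import Data.List.Membership.Propositional.Properties
  using (∈-concatMap⁺; ∈-upTo⁺; ∈-allFin; ∈-map⁺)
open import Data.Product using (Σ; _×_; _,_; proj₁; proj₂)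
open import Data.Sum using (_⊎_; inj₁; inj₂)
open import Data.Empty using (⊥; ⊥-elim)
open import Relation.Nullary using (¬_; Dec; yes; no)
open import Relation.Nullary.Decidable using (⌊_⌋; dec-true; dec-false; isYes≗does)
open import Relation.Binary.Definitions using (tri<; tri≈; tri>)
open import Relation.Binary.PropositionalEquality hiding ([_])
open import Function.Bundles using (_⇔_; Equivalence)
open import Algebra.Properties.Semiring.Sum +-*-semiring
  using (sum; sum-cong-≗; ∑-distrib-+; ∑-comm; *-distribˡ-sum)
open import Algebra.Properties.CommutativeMonoid.Sum *-1-commutativeMonoid
  using () renaming (sum to product; sum-remove to product-remove)


sumℕ≡sum : ∀ {m} (f : Fin m → ℕ) → sumℕ f ≡ sum f
sumℕ≡sum {zero} f = refl
sumℕ≡sum {suc m} f = cong (f fz +_) (sumℕ≡sum (λ i → f (fs i)))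

sum-cong : ∀ {m} (f g : Fin m → ℕ) → (∀ i → f i ≡ g i) → sumℕ f ≡ sumℕ g
sum-cong {zero} f g h = refl
sum-cong {suc m} f g h = cong₂ _+_ (h fz) (sum-cong (λ i → f (fs i)) (λ i → g (fs i)) (λ i → h (fs i)))

sum-+ : ∀ {m} (f g : Fin m → ℕ) → sumℕ (λ i → f i + g i) ≡ sumℕ f + sumℕ g
sum-+ f g = begin
  sumℕ (λ i → f i + g i) ≡⟨ sumℕ≡sum (λ i → f i + g i) ⟩
  sum (λ i → f i + g i)  ≡⟨ ∑-distrib-+ f g ⟩
  sum f + sum g          ≡⟨ sym (cong₂ _+_ (sumℕ≡sum f) (sumℕ≡sum g)) ⟩
  sumℕ f + sumℕ g        ∎
  where open ≡-Reasoning

sum-*ˡ : ∀ {m} (a : ℕ) (f : Fin m → ℕ) → a * sumℕ f ≡ sumℕ (λ i → a * f i)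
sum-*ˡ a f = begin
  a * sumℕ f          ≡⟨ cong (a *_) (sumℕ≡sum f) ⟩
  a * sum f           ≡⟨ *-distribˡ-sum a f ⟩
  sum (λ i → a * f i) ≡⟨ sym (sumℕ≡sum (λ i → a * f i)) ⟩
  sumℕ (λ i → a * f i) ∎
  where open ≡-Reasoning

sum-swap : ∀ {m n} (f : Fin m → Fin n → ℕ) →
  sumℕ (λ i → sumℕ (λ j → f i j)) ≡ sumℕ (λ j → sumℕ (λ i → f i j))
sum-swap f = begin
  sumℕ (λ i → sumℕ (f i))               ≡⟨ double f ⟩
  sum (λ i → sum (f i))                 ≡⟨ ∑-comm f ⟩
  sum (λ j → sum (λ i → f i j))         ≡⟨ sym (double (λ j i → f i j)) ⟩
  sumℕ (λ j → sumℕ (λ i → f i j))       ∎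
  where
  open ≡-Reasoning
  double : ∀ {m n} (g : Fin m → Fin n → ℕ) → sumℕ (λ i → sumℕ (g i)) ≡ sum (λ i → sum (g i))
  double g = trans (sumℕ≡sum (λ i → sumℕ (g i))) (sum-cong-≗ (λ i → sumℕ≡sum (g i)))

sum-zero : ∀ {m} (f : Fin m → ℕ) → (∀ i → f i ≡ 0) → sumℕ f ≡ 0
sum-zero {zero} f h = refl
sum-zero {suc m} f h = cong₂ _+_ (h fz) (sum-zero (λ i → f (fs i)) (λ i → h (fs i)))

sum-mono : ∀ {m} (f g : Fin m → ℕ) → (∀ i → f i ≤ g i) → sumℕ f ≤ sumℕ g
sum-mono {zero} f g h = z≤n
sum-mono {suc m} f g h = +-mono-≤ (h fz) (sum-mono (λ i → f (fs i)) (λ i → g (fs i)) (λ i → h (fs i)))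

term≤sum : ∀ {m} (f : Fin m → ℕ) (i : Fin m) → f i ≤ sumℕ f
term≤sum {suc m} f fz = m≤m+n (f fz) _
term≤sum {suc m} f (fs i) = ≤-trans (term≤sum (λ i → f (fs i)) i) (m≤n+m _ (f fz))

sum-const : ∀ m c → sumℕ {m} (λ _ → c) ≡ m * c
sum-const zero c = refl
sum-const (suc m) c = cong (c +_) (sum-const m c)

sum-single : ∀ {m} (f : Fin m → ℕ) (i : Fin m) → (∀ j → ¬ j ≡ i → f j ≡ 0) → sumℕ f ≡ f i
sum-single {suc m} f fz h = begin
  f fz + sumℕ (λ j → f (fs j)) ≡⟨ cong (f fz +_) (sum-zero _ (λ j → h (fs j) (λ ()))) ⟩
  f fz + 0                     ≡⟨ +-identityʳ _ ⟩
  f fz                         ∎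
  where open ≡-Reasoning
sum-single {suc m} f (fs i) h =
  cong₂ _+_ (h fz (λ ())) (sum-single (λ j → f (fs j)) i (λ j j≢i → h (fs j) (λ e → j≢i (fs-injective e))))

holds : ∀ {A : Set} (d : Dec A) → ⌊ d ⌋ ≡ true → A
holds (yes a) _ = a
holds (no _) ()

⌊⌋-true : ∀ {A : Set} (d : Dec A) → A → ⌊ d ⌋ ≡ true
⌊⌋-true d a = trans (isYes≗does d) (dec-true d a)

⌊⌋-false : ∀ {A : Set} (d : Dec A) → ¬ A → ⌊ d ⌋ ≡ false
⌊⌋-false d ¬a = trans (isYes≗does d) (dec-false d ¬a)

∧-elim : ∀ x y → x ∧ y ≡ true → x ≡ true × y ≡ true
∧-elim true true _ = refl , refl

∧-intro : ∀ {x y} → x ≡ true → y ≡ true → x ∧ y ≡ true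
∧-intro refl refl = refl

∨-elim : ∀ x y → x ∨ y ≡ true → x ≡ true ⊎ y ≡ true
∨-elim true y _ = inj₁ refl
∨-elim false y e = inj₂ e

ind : Bool → ℕ
ind b = if b then 1 else 0

module _ {ℓ : ℕ} where

  ≡ᶠ-true : ∀ (a b : Fin ℓ) → (a ≡ᶠ b) ≡ true → a ≡ b
  ≡ᶠ-true a b e = toℕ-injective (holds (toℕ a ℕ.≟ toℕ b) e)

  ≡ᶠ-refl : ∀ (a : Fin ℓ) → (a ≡ᶠ a) ≡ true
  ≡ᶠ-refl a = ⌊⌋-true (toℕ a ℕ.≟ toℕ a) refl

  ≡ᶠ-false : ∀ (a b : Fin ℓ) → ¬ toℕ a ≡ toℕ b → (a ≡ᶠ b) ≡ false
  ≡ᶠ-false a b ne = ⌊⌋-false (toℕ a ℕ.≟ toℕ b) ne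

  ≢ᶠ : ∀ (a b : Fin ℓ) → ¬ a ≡ b → (a ≡ᶠ b) ≡ false
  ≢ᶠ a b ne = ≡ᶠ-false a b (λ e → ne (toℕ-injective e))

  count-++ : ∀ (a : Fin ℓ) xs ys → countLetter a (xs ++ ys) ≡ countLetter a xs + countLetter a ys
  count-++ a [] ys = refl
  count-++ a (x ∷ xs) ys = trans (cong (ind (a ≡ᶠ x) +_) (count-++ a xs ys)) (sym (+-assoc (ind (a ≡ᶠ x)) _ _))

  count-self : ∀ (a : Fin ℓ) w → countLetter a (a ∷ w) ≡ suc (countLetter a w)
  count-self a w = cong (λ z → ind z + countLetter a w) (≡ᶠ-refl a)

  count-block : ∀ (a : Fin ℓ) n → countLetter a (replicate n a) ≡ n
  count-block a zero = refl
  count-block a (suc n) = trans (count-self a (replicate n a)) (cong suc (count-block a n))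

  count-other-block : ∀ (a b : Fin ℓ) n → ¬ b ≡ a → countLetter a (replicate n b) ≡ 0
  count-other-block a b zero ne = refl
  count-other-block a b (suc n) ne =
    cong₂ _+_ (cong ind (≢ᶠ a b (λ e → ne (sym e)))) (count-other-block a b n ne)

  count≤length : ∀ (a : Fin ℓ) w → countLetter a w ≤ length w
  count≤length a [] = z≤n
  count≤length a (b ∷ w) with a ≡ᶠ b
  ... | true = s≤s (count≤length a w)
  ... | false = m≤n⇒m≤1+n (count≤length a w)

  blocks : (Fin ℓ → ℕ) → List (Fin ℓ) → Word ℓ
  blocks e L = concatMap (λ a → replicate (e a) a) L

  word : (Fin ℓ → ℕ) → Word ℓ
  word e = blocks e (allFin ℓ)

count-blocks : ∀ {ℓ n} (a : Fin ℓ) (e : Fin ℓ → ℕ) (h : Fin n → Fin ℓ) →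
  countLetter a (blocks e (tabulate h)) ≡ sumℕ (λ i → countLetter a (replicate (e (h i)) (h i)))
count-blocks {n = zero} a e h = refl
count-blocks {n = suc n} a e h =
  trans (count-++ a (replicate (e (h fz)) (h fz)) _)
        (cong (countLetter a (replicate (e (h fz)) (h fz)) +_) (count-blocks a e (λ i → h (fs i))))

length-blocks : ∀ {ℓ n} (e : Fin ℓ → ℕ) (h : Fin n → Fin ℓ) →
  length (blocks e (tabulate h)) ≡ sumℕ (λ i → e (h i))
length-blocks {n = zero} e h = refl
length-blocks {n = suc n} e h =
  trans (length-++ (replicate (e (h fz)) (h fz)))
        (cong₂ _+_ (length-replicate (e (h fz))) (length-blocks e (λ i → h (fs i))))

Ψ-word : ∀ {ℓ} (e : Fin ℓ → ℕ) a → Ψ (word e) a ≡ e a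
Ψ-word e a = begin
  countLetter a (blocks e (tabulate (λ x → x)))     ≡⟨ count-blocks a e (λ x → x) ⟩
  sumℕ (λ i → countLetter a (replicate (e i) i))    ≡⟨ sum-single _ a (λ j ne → count-other-block a j (e j) ne) ⟩
  countLetter a (replicate (e a) a)                 ≡⟨ count-block a (e a) ⟩
  e a                                               ∎
  where open ≡-Reasoning

length-word : ∀ {ℓ} (e : Fin ℓ → ℕ) → length (word e) ≡ sumℕ e
length-word e = length-blocks e (λ x → x)

module _ {ℓ : ℕ} where

  _≤ₗ_ : Fin ℓ → Fin ℓ → Set
  a ≤ₗ b = toℕ a ≤ toℕ b

  Sorted : Word ℓ → Set
  Sorted = AllPairs _≤ₗ_

  InB⇒Sorted : ∀ (w : Word ℓ) → InB w → Sorted w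
  InB⇒Sorted [] _ = []
  InB⇒Sorted (a ∷ []) _ = [] ∷ []
  InB⇒Sorted (a ∷ b ∷ w) s =
    cons (holds (toℕ a ≤? toℕ b) (proj₁ split)) (InB⇒Sorted (b ∷ w) (proj₂ split))
    where
    split = ∧-elim (a ≤ᶠ b) (sortedᵇ (b ∷ w)) s
    cons : a ≤ₗ b → Sorted (b ∷ w) → Sorted (a ∷ b ∷ w)
    cons a≤b (b≤w ∷ rest) = (a≤b ∷ All.map (≤-trans a≤b) b≤w) ∷ b≤w ∷ rest

  count-absent : ∀ (a : Fin ℓ) w → All (λ x → toℕ a < toℕ x) w → countLetter a w ≡ 0
  count-absent a [] _ = refl
  count-absent a (x ∷ w) (p ∷ ps) =
    cong₂ _+_ (cong ind (≡ᶠ-false a x (λ e → <-irrefl e p))) (count-absent a w ps)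

  below-all : ∀ {a b : Fin ℓ} {w} → toℕ a < toℕ b → All (b ≤ₗ_) w → All (λ x → toℕ a < toℕ x) w
  below-all a<b = All.map (<-≤-trans a<b)

  Ψ-injective : ∀ (u v : Word ℓ) → Sorted u → Sorted v → (∀ a → Ψ u a ≡ Ψ v a) → u ≡ v
  Ψ-injective [] [] _ _ h = refl
  Ψ-injective [] (b ∷ v) _ _ h with trans (h b) (count-self b v)
  ... | ()
  Ψ-injective (a ∷ u) [] _ _ h with trans (sym (h a)) (count-self a u)
  ... | ()
  Ψ-injective (a ∷ u) (b ∷ v) (pa ∷ su) (pb ∷ sv) h with <-cmp (toℕ a) (toℕ b)
  ... | tri< a<b _ _ with trans (sym (count-self a u)) (trans (h a) (count-absent a (b ∷ v) (a<b ∷ below-all a<b pb)))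
  ...   | ()
  Ψ-injective (a ∷ u) (b ∷ v) (pa ∷ su) (pb ∷ sv) h | tri> _ _ b<a
    with trans (sym (count-self b v)) (trans (sym (h b)) (count-absent b (a ∷ u) (b<a ∷ below-all b<a pa)))
  ...   | ()
  Ψ-injective (a ∷ u) (b ∷ v) (pa ∷ su) (pb ∷ sv) h | tri≈ _ a≡b _ with toℕ-injective a≡b
  ...   | refl = cong (a ∷_) (Ψ-injective u v su sv (λ x → +-cancelˡ-≡ (ind (x ≡ᶠ a)) _ _ (h x)))

  all-block : ∀ (a : Fin ℓ) n {P : Fin ℓ → Set} → P a → All P (replicate n a)
  all-block a zero p = []
  all-block a (suc n) p = p ∷ all-block a n p

  sorted-block : ∀ (a : Fin ℓ) n → Sorted (replicate n a)
  sorted-block a zero = []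
  sorted-block a (suc n) = all-block a n ≤-refl ∷ sorted-block a n

  sorted-++ : ∀ xs ys → Sorted xs → Sorted ys → All (λ x → All (x ≤ₗ_) ys) xs → Sorted (xs ++ ys)
  sorted-++ [] ys _ s _ = s
  sorted-++ (x ∷ xs) ys (p ∷ ps) s (q ∷ qs) = ++⁺ p q ∷ sorted-++ xs ys ps s qs

  all-blocks : ∀ {n} (e : Fin ℓ → ℕ) (h : Fin n → Fin ℓ) {P : Fin ℓ → Set} →
    (∀ i → P (h i)) → All P (blocks e (tabulate h))
  all-blocks {zero} e h p = []
  all-blocks {suc n} e h p =
    ++⁺ (all-block (h fz) (e (h fz)) (p fz)) (all-blocks e (λ i → h (fs i)) (λ i → p (fs i)))

  sorted-blocks : ∀ {n} (e : Fin ℓ → ℕ) (h : Fin n → Fin ℓ) →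
    (∀ i j → toℕ i ≤ toℕ j → h i ≤ₗ h j) → Sorted (blocks e (tabulate h))
  sorted-blocks {zero} e h mono = []
  sorted-blocks {suc n} e h mono =
    sorted-++ first rest (sorted-block (h fz) (e (h fz)))
      (sorted-blocks e (λ i → h (fs i)) (λ i j p → mono (fs i) (fs j) (s≤s p)))
      (all-block (h fz) (e (h fz)) (all-blocks e (λ i → h (fs i)) (λ i → mono fz (fs i) z≤n)))
    where
    first = replicate (e (h fz)) (h fz)
    rest = blocks e (tabulate (λ i → h (fs i)))

sorted-word : ∀ {ℓ} (w : Word ℓ) → Sorted w → w ≡ word (Ψ w)
sorted-word w s = Ψ-injective w (word (Ψ w)) s (sorted-blocks (Ψ w) (λ x → x) (λ i j p → p)) (λ a → sym (Ψ-word (Ψ w) a))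

iter : ∀ {A : Set} → (A → A) → ℕ → A → A
iter g zero s = s
iter g (suc n) s = iter g n (g s)

iter-+ : ∀ {A : Set} (g : A → A) m n s → iter g (m + n) s ≡ iter g n (iter g m s)
iter-+ g zero n s = refl
iter-+ g (suc m) n s = iter-+ g m n (g s)

foldl-block : ∀ {A B : Set} (δ : A → B → A) q n a → foldl δ q (replicate n a) ≡ iter (λ s → δ s a) n q
foldl-block δ q zero a = refl
foldl-block δ q (suc n) a = foldl-block δ (δ q a) n a

iter-periodic : ∀ {A : Set} (g : A → A) d x → iter g d x ≡ x → ∀ c → iter g (c * d) x ≡ x
iter-periodic g d x h zero = refl
iter-periodic g d x h (suc c) =
  trans (iter-+ g d (c * d) x) (trans (cong (iter g (c * d)) h) (iter-periodic g d x h c))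

-- By pigeonhole, the orbit of s under g : Fin Q → Fin Q enters a cycle of
-- length d ≥ 1 after a steps, with a + d ≤ Q.
orbit-cycle : ∀ Q (g : Fin Q → Fin Q) (s : Fin Q) →
  Σ ℕ λ a → Σ ℕ λ d → a + d ≤ Q × 1 ≤ d × iter g d (iter g a s) ≡ iter g a s
orbit-cycle Q g s with pigeonhole (n<1+n Q) (λ i → iter g (toℕ i) s)
... | i , j , i<j , gi≡gj = toℕ i , toℕ j ∸ toℕ i , a+d≤Q , m<n⇒0<n∸m i<j , cycle
  where
  a+d≡b : toℕ i + (toℕ j ∸ toℕ i) ≡ toℕ j
  a+d≡b = m+[n∸m]≡n (<⇒≤ i<j)
  a+d≤Q : toℕ i + (toℕ j ∸ toℕ i) ≤ Q
  a+d≤Q = subst (_≤ Q) (sym a+d≡b) (≤-pred (toℕ<n j))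
  cycle : iter g (toℕ j ∸ toℕ i) (iter g (toℕ i) s) ≡ iter g (toℕ i) s
  cycle = trans (sym (iter-+ g (toℕ i) _ s)) (trans (cong (λ z → iter g z s) a+d≡b) (sym gi≡gj))

pump : ∀ Q (g : Fin Q → Fin Q) (s : Fin Q) n t → Q ≤ n → iter g (n + t * Q !) s ≡ iter g n s
pump Q g s n t Q≤n with orbit-cycle Q g s
... | a , d , a+d≤Q , d≥1 , cycle = begin
  iter g (n + t * Q !) s              ≡⟨ cong (λ z → iter g z s) split ⟩
  iter g (a + ((t * q) * d + r)) s    ≡⟨ iter-+ g a _ s ⟩
  iter g ((t * q) * d + r) x          ≡⟨ iter-+ g ((t * q) * d) r x ⟩
  iter g r (iter g ((t * q) * d) x)   ≡⟨ cong (iter g r) (iter-periodic g d x cycle (t * q)) ⟩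
  iter g r x                          ≡⟨ sym (iter-+ g a r s) ⟩
  iter g (a + r) s                    ≡⟨ cong (λ z → iter g z s) (m+[n∸m]≡n a≤n) ⟩
  iter g n s                          ∎
  where
  open ≡-Reasoning
  x = iter g a s
  r = n ∸ a
  a≤n : a ≤ n
  a≤n = ≤-trans (m≤m+n a d) (≤-trans a+d≤Q Q≤n)
  d∣Q! : d ∣ Q !
  d∣Q! = ∣-trans (d∣d! d d≥1) (m≤n⇒m!∣n! (≤-trans (m≤n+m d a) a+d≤Q))
    where
    d∣d! : ∀ d → 1 ≤ d → d ∣ d !
    d∣d! (suc d) _ = divides (d !) (*-comm (suc d) (d !))
  q = _∣_.quotient d∣Q!
  split : n + t * Q ! ≡ a + ((t * q) * d + r)
  split = begin
    n + t * Q !             ≡⟨ cong₂ (λ u v → u + t * v) (sym (m+[n∸m]≡n a≤n)) (_∣_.equality d∣Q!) ⟩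
    a + r + t * (q * d)     ≡⟨ rearrange a r t q d ⟩
    a + ((t * q) * d + r)   ∎
    where
    rearrange : ∀ a r t q d → a + r + t * (q * d) ≡ a + ((t * q) * d + r)
    rearrange = solve-∀

Pumping : ∀ {ℓ} (Q : ℕ) (e e′ : Fin ℓ → ℕ) → Set
Pumping Q e e′ = ∀ a → e′ a ≡ e a ⊎ (Q ≤ e a × Σ ℕ λ t → e′ a ≡ e a + t * Q !)

run-pumped : ∀ {ℓ} Q (δ : Fin Q → Fin ℓ → Fin Q) (e e′ : Fin ℓ → ℕ) → Pumping Q e e′ →
  ∀ (L : List (Fin ℓ)) q → foldl δ q (blocks e′ L) ≡ foldl δ q (blocks e L)
run-pumped Q δ e e′ pumping [] q = refl
run-pumped Q δ e e′ pumping (a ∷ L) q = begin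
  foldl δ q (replicate (e′ a) a ++ blocks e′ L)          ≡⟨ foldl-++ δ q (replicate (e′ a) a) _ ⟩
  foldl δ (foldl δ q (replicate (e′ a) a)) (blocks e′ L) ≡⟨ cong (λ z → foldl δ z (blocks e′ L)) same-block ⟩
  foldl δ (foldl δ q (replicate (e a) a)) (blocks e′ L)  ≡⟨ run-pumped Q δ e e′ pumping L _ ⟩
  foldl δ (foldl δ q (replicate (e a) a)) (blocks e L)   ≡⟨ sym (foldl-++ δ q (replicate (e a) a) _) ⟩
  foldl δ q (replicate (e a) a ++ blocks e L)            ∎
  where
  open ≡-Reasoning
  same-block : foldl δ q (replicate (e′ a) a) ≡ foldl δ q (replicate (e a) a)
  same-block with pumping a
  ... | inj₁ eq = cong (λ z → foldl δ q (replicate z a)) eq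
  ... | inj₂ (Q≤ , t , eq) = begin
    foldl δ q (replicate (e′ a) a)          ≡⟨ cong (λ z → foldl δ q (replicate z a)) eq ⟩
    foldl δ q (replicate (e a + t * Q !) a) ≡⟨ foldl-block δ q (e a + t * Q !) a ⟩
    iter (λ s → δ s a) (e a + t * Q !) q    ≡⟨ pump Q (λ s → δ s a) q (e a) t Q≤ ⟩
    iter (λ s → δ s a) (e a) q              ≡⟨ sym (foldl-block δ q (e a) a) ⟩
    foldl δ q (replicate (e a) a)           ∎

countWhere : ∀ {A : Set} → (A → Bool) → List A → ℕ
countWhere p xs = length (filter (λ x → T? (p x)) xs)

module _ {A : Set} where

  countWhere-++ : ∀ (p : A → Bool) xs ys → countWhere p (xs ++ ys) ≡ countWhere p xs + countWhere p ys
  countWhere-++ p xs ys =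
    trans (cong length (filter-++ (λ x → T? (p x)) xs ys)) (length-++ (filter (λ x → T? (p x)) xs))

  countWhere-none : ∀ (p : A → Bool) xs → All (λ x → p x ≡ false) xs → countWhere p xs ≡ 0
  countWhere-none p [] _ = refl
  countWhere-none p (x ∷ xs) (px ∷ pxs) rewrite px = countWhere-none p xs pxs

  countWhere-mono : ∀ (p q : A → Bool) → (∀ x → p x ≡ true → q x ≡ true) →
    ∀ xs → countWhere p xs ≤ countWhere q xs
  countWhere-mono p q p⇒q [] = z≤n
  countWhere-mono p q p⇒q (x ∷ xs) with p x in px | q x in qx
  ... | true | true = s≤s (countWhere-mono p q p⇒q xs)
  ... | true | false with trans (sym (p⇒q x px)) qx
  ...   | ()
  countWhere-mono p q p⇒q (x ∷ xs) | false | true = m≤n⇒m≤1+n (countWhere-mono p q p⇒q xs)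
  countWhere-mono p q p⇒q (x ∷ xs) | false | false = countWhere-mono p q p⇒q xs

  countWhere-strict : ∀ (p q : A → Bool) → (∀ x → p x ≡ true → q x ≡ true) →
    ∀ xs y → y ∈ xs → q y ≡ true → p y ≡ false → countWhere p xs < countWhere q xs
  countWhere-strict p q p⇒q (x ∷ xs) y (here refl) qy py rewrite qy | py = s≤s (countWhere-mono p q p⇒q xs)
  countWhere-strict p q p⇒q (x ∷ xs) y (there y∈xs) qy py with p x in px | q x in qx
  ... | true | true = s≤s (countWhere-strict p q p⇒q xs y y∈xs qy py)
  ... | true | false with trans (sym (p⇒q x px)) qx
  ...   | ()
  countWhere-strict p q p⇒q (x ∷ xs) y (there y∈xs) qy py | false | true =
    m≤n⇒m≤1+n (countWhere-strict p q p⇒q xs y y∈xs qy py)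
  countWhere-strict p q p⇒q (x ∷ xs) y (there y∈xs) qy py | false | false =
    countWhere-strict p q p⇒q xs y y∈xs qy py

module _ {ℓ : ℕ} where

  length-wordsOfLength : ∀ n → All (λ (x : Word ℓ) → length x ≡ n) (wordsOfLength ℓ n)
  length-wordsOfLength zero = refl ∷ []
  length-wordsOfLength (suc n) = concat⁺ (map⁺ (All.map extend (length-wordsOfLength n)))
    where
    extend : ∀ {w : Word ℓ} → length w ≡ n → All (λ x → length x ≡ suc n) (map (λ a → a ∷ w) (allFin ℓ))
    extend |w|≡n = map⁺ (All.tabulate (λ _ → cong suc |w|≡n))

  ∈-wordsOfLength : ∀ (w : Word ℓ) → w ∈ wordsOfLength ℓ (length w)
  ∈-wordsOfLength [] = here refl
  ∈-wordsOfLength (a ∷ w) =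
    ∈-concatMap⁺ (λ w → map (λ a → a ∷ w) (allFin ℓ)) (lose (∈-wordsOfLength w) (∈-map⁺ (λ a → a ∷ w) (∈-allFin a)))

  ∈-wordsUpTo : ∀ (w : Word ℓ) N → length w ≤ N → w ∈ wordsUpTo ℓ N
  ∈-wordsUpTo w N |w|≤N = ∈-concatMap⁺ (wordsOfLength ℓ) (lose (∈-upTo⁺ (s≤s |w|≤N)) (∈-wordsOfLength w))

  wordsUpTo-suc : ∀ n → wordsUpTo ℓ (suc n) ≡ wordsUpTo ℓ n ++ wordsOfLength ℓ (suc n)
  wordsUpTo-suc n = begin
    concatMap (wordsOfLength ℓ) (upTo (suc (suc n)))
      ≡⟨ cong (concatMap (wordsOfLength ℓ)) (sym (applyUpTo-∷ʳ (λ x → x) (suc n))) ⟩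
    concatMap (wordsOfLength ℓ) (upTo (suc n) ++ [ suc n ])
      ≡⟨ concatMap-++ (wordsOfLength ℓ) (upTo (suc n)) [ suc n ] ⟩
    wordsUpTo ℓ n ++ (wordsOfLength ℓ (suc n) ++ [])
      ≡⟨ cong (wordsUpTo ℓ n ++_) (++-identityʳ _) ⟩
    wordsUpTo ℓ n ++ wordsOfLength ℓ (suc n) ∎
    where open ≡-Reasoning

  lex-view : ∀ (a b : Fin ℓ) u v → lexLtᵇ (a ∷ u) (b ∷ v) ≡ true →
    toℕ a < toℕ b ⊎ (a ≡ b × lexLtᵇ u v ≡ true)
  lex-view a b u v lt with ∨-elim (a <ᶠ b) _ lt
  ... | inj₁ a<b = inj₁ (holds (toℕ a <? toℕ b) a<b)
  ... | inj₂ rest with ∧-elim (a ≡ᶠ b) _ rest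
  ...   | a≡b , u<v = inj₂ (≡ᶠ-true a b a≡b , u<v)

  lex-head : ∀ (a b : Fin ℓ) u v → toℕ a < toℕ b → lexLtᵇ (a ∷ u) (b ∷ v) ≡ true
  lex-head a b u v a<b = cong (λ z → z ∨ ((a ≡ᶠ b) ∧ lexLtᵇ u v)) (⌊⌋-true (toℕ a <? toℕ b) a<b)

  lex-tail : ∀ (a : Fin ℓ) u v → lexLtᵇ u v ≡ true → lexLtᵇ (a ∷ u) (a ∷ v) ≡ true
  lex-tail a u v u<v =
    trans (cong₂ (λ x y → x ∨ (y ∧ lexLtᵇ u v)) (⌊⌋-false (toℕ a <? toℕ a) (<-irrefl refl)) (≡ᶠ-refl a)) u<v

  lex-irrefl : ∀ (u : Word ℓ) → lexLtᵇ u u ≡ false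
  lex-irrefl [] = refl
  lex-irrefl (a ∷ u) =
    cong₂ _∨_ (⌊⌋-false (toℕ a <? toℕ a) (<-irrefl refl)) (cong₂ _∧_ (≡ᶠ-refl a) (lex-irrefl u))

  lex-trans : ∀ (x y z : Word ℓ) → lexLtᵇ x y ≡ true → lexLtᵇ y z ≡ true → lexLtᵇ x z ≡ true
  lex-trans [] (b ∷ v) (c ∷ w) _ _ = refl
  lex-trans [] [] _ () _
  lex-trans [] (b ∷ v) [] _ ()
  lex-trans (a ∷ u) [] _ () _
  lex-trans (a ∷ u) (b ∷ v) [] _ ()
  lex-trans (a ∷ u) (b ∷ v) (c ∷ w) x<y y<z with lex-view a b u v x<y | lex-view b c v w y<z
  ... | inj₁ a<b | inj₁ b<c = lex-head a c u w (<-trans a<b b<c)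
  ... | inj₁ a<b | inj₂ (refl , _) = lex-head a b u w a<b
  ... | inj₂ (refl , _) | inj₁ b<c = lex-head a c u w b<c
  ... | inj₂ (refl , u<v) | inj₂ (refl , v<w) = lex-tail a u w (lex-trans u v w u<v v<w)

  lex-trichotomy : ∀ (u v : Word ℓ) → length u ≡ length v →
    u ≡ v ⊎ (lexLtᵇ u v ≡ true ⊎ lexLtᵇ v u ≡ true)
  lex-trichotomy [] [] _ = inj₁ refl
  lex-trichotomy (a ∷ u) (b ∷ v) |u|≡|v| with <-cmp (toℕ a) (toℕ b)
  ... | tri< a<b _ _ = inj₂ (inj₁ (lex-head a b u v a<b))
  ... | tri> _ _ b<a = inj₂ (inj₂ (lex-head b a v u b<a))
  ... | tri≈ _ a≡b _ with toℕ-injective a≡b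
  ...   | refl with lex-trichotomy u v (suc-injective |u|≡|v|)
  ...     | inj₁ refl = inj₁ refl
  ...     | inj₂ (inj₁ u<v) = inj₂ (inj₁ (lex-tail a u v u<v))
  ...     | inj₂ (inj₂ v<u) = inj₂ (inj₂ (lex-tail a v u v<u))

  GenLt : Word ℓ → Word ℓ → Set
  GenLt x v = length x < length v ⊎ (length x ≡ length v × lexLtᵇ x v ≡ true)

  genLt⇒GenLt : ∀ (x v : Word ℓ) → genLtᵇ x v ≡ true → GenLt x v
  genLt⇒GenLt x v lt with ∨-elim _ _ lt
  ... | inj₁ shorter = inj₁ (holds (length x <? length v) shorter)
  ... | inj₂ rest with ∧-elim _ _ rest
  ...   | same , x<v = inj₂ (holds (length x ℕ.≟ length v) same , x<v)

  GenLt⇒genLt : ∀ (x v : Word ℓ) → GenLt x v → genLtᵇ x v ≡ true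
  GenLt⇒genLt x v (inj₁ shorter) =
    cong (λ z → z ∨ (⌊ length x ℕ.≟ length v ⌋ ∧ lexLtᵇ x v)) (⌊⌋-true (length x <? length v) shorter)
  GenLt⇒genLt x v (inj₂ (same , x<v)) =
    trans (cong₂ (λ y z → y ∨ (z ∧ lexLtᵇ x v))
                 (⌊⌋-false (length x <? length v) (λ lt → <-irrefl same lt))
                 (⌊⌋-true (length x ℕ.≟ length v) same)) x<v

  genLt-longer : ∀ (x v : Word ℓ) → length v < length x → genLtᵇ x v ≡ false
  genLt-longer x v |v|<|x| =
    cong₂ (λ y z → y ∨ (z ∧ lexLtᵇ x v))
          (⌊⌋-false (length x <? length v) (λ l → <-asym l |v|<|x|))
          (⌊⌋-false (length x ℕ.≟ length v) (λ e → <-irrefl (sym e) |v|<|x|))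

  genLt-irrefl : ∀ (v : Word ℓ) → genLtᵇ v v ≡ false
  genLt-irrefl v =
    trans (cong₂ (λ y z → y ∨ (z ∧ lexLtᵇ v v))
                 (⌊⌋-false (length v <? length v) (<-irrefl refl))
                 (⌊⌋-true (length v ℕ.≟ length v) refl)) (lex-irrefl v)

  GenLt-trans : ∀ (x y z : Word ℓ) → GenLt x y → GenLt y z → GenLt x z
  GenLt-trans x y z (inj₁ l₁) (inj₁ l₂) = inj₁ (<-trans l₁ l₂)
  GenLt-trans x y z (inj₁ l₁) (inj₂ (e , _)) = inj₁ (subst (length x <_) e l₁)
  GenLt-trans x y z (inj₂ (e , _)) (inj₁ l₂) = inj₁ (subst (_< length z) (sym e) l₂)
  GenLt-trans x y z (inj₂ (e₁ , l₁)) (inj₂ (e₂ , l₂)) = inj₂ (trans e₁ e₂ , lex-trans x y z l₁ l₂)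

  Below : Word ℓ → Word ℓ → Bool
  Below v x = sortedᵇ x ∧ genLtᵇ x v

  valUpTo : ℕ → Word ℓ → ℕ
  valUpTo n v = countWhere (Below v) (wordsUpTo ℓ n)

  -- enlarging the enumeration beyond |v| adds no word below v
  valUpTo-stable : ∀ (v : Word ℓ) n → length v ≤ n → valUpTo n v ≡ val v
  valUpTo-stable v n |v|≤n = trans (cong (λ m → valUpTo m v) (sym (m+[n∸m]≡n |v|≤n))) (go (n ∸ length v))
    where
    go : ∀ d → valUpTo (length v + d) v ≡ val v
    go zero = cong (λ n → valUpTo n v) (+-identityʳ (length v))
    go (suc d) = begin
      valUpTo (length v + suc d) v
        ≡⟨ cong (λ n → countWhere (Below v) (wordsUpTo ℓ n)) (+-suc (length v) d) ⟩
      countWhere (Below v) (wordsUpTo ℓ (suc (length v + d)))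
        ≡⟨ cong (countWhere (Below v)) (wordsUpTo-suc (length v + d)) ⟩
      countWhere (Below v) (wordsUpTo ℓ (length v + d) ++ longer)
        ≡⟨ countWhere-++ (Below v) (wordsUpTo ℓ (length v + d)) longer ⟩
      valUpTo (length v + d) v + countWhere (Below v) longer
        ≡⟨ cong₂ _+_ (go d) (countWhere-none (Below v) longer (All.map (λ {x} → not-below {x}) (length-wordsOfLength (suc (length v + d))))) ⟩
      val v + 0
        ≡⟨ +-identityʳ _ ⟩
      val v ∎
      where
      open ≡-Reasoning
      longer = wordsOfLength ℓ (suc (length v + d))
      not-below : ∀ {x} → length x ≡ suc (length v + d) → Below v x ≡ false
      not-below {x} |x|≡ =
        trans (cong (sortedᵇ x ∧_) (genLt-longer x v (subst (length v <_) (sym |x|≡) (s≤s (m≤m+n (length v) d)))))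
              (∧-zeroʳ (sortedᵇ x))

  val-strict : ∀ (v v′ : Word ℓ) → InB v → genLtᵇ v v′ ≡ true → val v < val v′
  val-strict v v′ v∈B v<v′ =
    subst (_< val v′) (valUpTo-stable v (length v′) |v|≤|v′|)
      (countWhere-strict (Below v) (Below v′) below-trans (wordsUpTo ℓ (length v′)) v
        (∈-wordsUpTo v (length v′) |v|≤|v′|) (∧-intro v∈B v<v′) v-not-below-v)
    where
    |v|≤|v′| : length v ≤ length v′
    |v|≤|v′| with genLt⇒GenLt v v′ v<v′
    ... | inj₁ shorter = <⇒≤ shorter
    ... | inj₂ (same , _) = ≤-reflexive same
    below-trans : ∀ x → Below v x ≡ true → Below v′ x ≡ true
    below-trans x x<v with ∧-elim (sortedᵇ x) _ x<v
    ... | x∈B , x<v′ = ∧-intro x∈B (GenLt⇒genLt x v′ (GenLt-trans x v v′ (genLt⇒GenLt x v x<v′) (genLt⇒GenLt v v′ v<v′)))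
    v-not-below-v : Below v v ≡ false
    v-not-below-v = trans (cong (sortedᵇ v ∧_) (genLt-irrefl v)) (∧-zeroʳ (sortedᵇ v))

  val-length : ∀ (u v : Word ℓ) → InB u → InB v → val u ≤ val v → length u ≤ length v
  val-length u v u∈B v∈B val≤ with length u ≤? length v
  ... | yes |u|≤|v| = |u|≤|v|
  ... | no |u|≰|v| = ⊥-elim (<⇒≱ (val-strict v u v∈B (GenLt⇒genLt v u (inj₁ (≰⇒> |u|≰|v|)))) val≤)

  val-injective : ∀ (u v : Word ℓ) → InB u → InB v → val u ≡ val v → u ≡ v
  val-injective u v u∈B v∈B same with <-cmp (length u) (length v)
  ... | tri< lt _ _ = ⊥-elim (<-irrefl same (val-strict u v u∈B (GenLt⇒genLt u v (inj₁ lt))))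
  ... | tri> _ _ gt = ⊥-elim (<-irrefl (sym same) (val-strict v u v∈B (GenLt⇒genLt v u (inj₁ gt))))
  ... | tri≈ _ |u|≡|v| _ with lex-trichotomy u v |u|≡|v|
  ...   | inj₁ u≡v = u≡v
  ...   | inj₂ (inj₁ u<v) =
    ⊥-elim (<-irrefl same (val-strict u v u∈B (GenLt⇒genLt u v (inj₂ (|u|≡|v| , u<v)))))
  ...   | inj₂ (inj₂ v<u) =
    ⊥-elim (<-irrefl (sym same) (val-strict v u v∈B (GenLt⇒genLt v u (inj₂ (sym |u|≡|v| , v<u)))))

product-pos : ∀ {m} (d : Fin m → ℕ) → (∀ j → 1 ≤ d j) → 1 ≤ product d
product-pos {zero} d pos = s≤s z≤n
product-pos {suc m} d pos = *-mono-≤ (pos fz) (product-pos (λ j → d (fs j)) (λ j → pos (fs j)))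

product-factor : ∀ {m} (d : Fin m → ℕ) → (∀ j → 1 ≤ d j) → ∀ j →
  Σ ℕ λ L → 1 ≤ L × product d ≡ d j * L
product-factor {suc m} d pos j =
  product (λ i → d (Fin.punchIn j i)) , product-pos _ (λ i → pos (Fin.punchIn j i)) , product-remove d

-- A natural-number relation D·x + Σ minus_i b_i = Σ plus_i b_i, i.e. x is a
-- rational combination of the b_i with denominator D; the zero vector gets
-- the trivial relation.
record Relation {ℓ k} (D : ℕ) (x : Fin ℓ → ℕ) (b : Fin k → Fin ℓ → ℕ) : Set where
  field
    plus minus : Fin k → ℕ
    balanced : ∀ a → D * x a + sumℕ (λ i → minus i * b i a) ≡ sumℕ (λ i → plus i * b i a)
    vanishes : (∀ a → x a ≡ 0) → ∀ i → plus i ≡ 0 × minus i ≡ 0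

Expressible : ∀ {ℓ k} → (Fin ℓ → ℕ) → (Fin k → Fin ℓ → ℕ) → Set
Expressible x b = Σ ℕ λ D → 1 ≤ D × Relation D x b

rescale : ∀ {ℓ k D} {x : Fin ℓ → ℕ} {b : Fin k → Fin ℓ → ℕ} → Relation D x b → ∀ L → Relation (D * L) x b
rescale {D = D} {x} {b} r L = record
  { plus = λ i → plus i * L ; minus = λ i → minus i * L ; balanced = scaled
  ; vanishes = λ x≡0 i → cong (_* L) (proj₁ (vanishes x≡0 i)) , cong (_* L) (proj₂ (vanishes x≡0 i)) }
  where
  open Relation r
  swap : ∀ u v w → u * v * w ≡ v * (u * w)
  swap = solve-∀
  pull : ∀ (f : Fin _ → ℕ) a → sumℕ (λ i → f i * L * b i a) ≡ L * sumℕ (λ i → f i * b i a)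
  pull f a = trans (sum-cong _ _ (λ i → swap (f i) L (b i a))) (sym (sum-*ˡ L (λ i → f i * b i a)))
  scaled : ∀ a → D * L * x a + sumℕ (λ i → minus i * L * b i a) ≡ sumℕ (λ i → plus i * L * b i a)
  scaled a = begin
    D * L * x a + sumℕ (λ i → minus i * L * b i a)   ≡⟨ cong₂ _+_ (swap D L (x a)) (pull minus a) ⟩
    L * (D * x a) + L * sumℕ (λ i → minus i * b i a) ≡⟨ sym (*-distribˡ-+ L _ _) ⟩
    L * (D * x a + sumℕ (λ i → minus i * b i a))     ≡⟨ cong (L *_) (balanced a) ⟩
    L * sumℕ (λ i → plus i * b i a)                  ≡⟨ sym (pull plus a) ⟩
    sumℕ (λ i → plus i * L * b i a)                  ∎
    where open ≡-Reasoning

common-denominator : ∀ {ℓ m k} (p : Fin m → Fin ℓ → ℕ) (b : Fin k → Fin ℓ → ℕ) →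
  (∀ j → Expressible (p j) b) → Σ ℕ λ D → 1 ≤ D × (∀ j → Relation D (p j) b)
common-denominator p b expr =
  product den , product-pos den (λ j → proj₁ (proj₂ (expr j))) , common
  where
  den : Fin _ → ℕ
  den j = proj₁ (expr j)
  common : ∀ j → Relation (product den) (p j) b
  common j with product-factor den (λ j → proj₁ (proj₂ (expr j))) j
  ... | L , _ , ∏≡ = subst (λ D → Relation D (p j) b) (sym ∏≡) (rescale (proj₂ (proj₂ (expr j))) L)

ι : ℤ → ℚ
ι z = mkℚ z 0 (coprime-sym (1-coprimeTo _))

ι-/1 : ∀ n → (ℤ.+ n) ℚ./ 1 ≡ ι (ℤ.+ n)
ι-/1 n = ℚP.↥p/↧p≡p (ι (ℤ.+ n))

ι-injective : ∀ a b → ι a ≡ ι b → a ≡ b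
ι-injective a b e = cong ↥_ e

ι-+ : ∀ a b → ι (a ℤ.+ b) ≡ ι a ℚ.+ ι b
ι-+ a b = ℚP.toℚᵘ-injective (≃-trans (*≡* (eq a b)) (≃-sym (ℚP.toℚᵘ-homo-+ (ι a) (ι b))))
  where
  eq : ∀ a b → (a ℤ.+ b) ℤ.* ℤ.+ 1 ≡ (a ℤ.* ℤ.+ 1 ℤ.+ b ℤ.* ℤ.+ 1) ℤ.* ℤ.+ 1
  eq = ℤSolver.solve-∀

ι-* : ∀ a b → ι (a ℤ.* b) ≡ ι a ℚ.* ι b
ι-* a b = ℚP.toℚᵘ-injective (≃-sym (ℚP.toℚᵘ-homo-* (ι a) (ι b)))

clear-denominator : ∀ (c : ℚ) K → c ℚ.* ι (ℤ.+ (↧ₙ c * K)) ≡ ι (↥ c ℤ.* ℤ.+ K)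
clear-denominator c@(mkℚ n d _) K =
  ℚP.toℚᵘ-injective (≃-trans (ℚP.toℚᵘ-homo-* c (ι (ℤ.+ (↧ₙ c * K)))) (*≡* cross))
  where
  rearrange : ∀ n D K → n ℤ.* (D ℤ.* K) ℤ.* ℤ.+ 1 ≡ n ℤ.* K ℤ.* (D ℤ.* ℤ.+ 1)
  rearrange = ℤSolver.solve-∀
  cross : n ℤ.* ℤ.+ (suc d * K) ℤ.* ℤ.+ 1 ≡ n ℤ.* ℤ.+ K ℤ.* ℤ.+ (suc d * 1)
  cross = trans (cong (λ z → n ℤ.* z ℤ.* ℤ.+ 1) (ℤP.pos-* (suc d) K))
         (trans (rearrange n (ℤ.+ suc d) (ℤ.+ K)) (cong (λ z → n ℤ.* ℤ.+ K ℤ.* z) (sym (ℤP.pos-* (suc d) 1))))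

sumℤ : ∀ {r} → (Fin r → ℤ) → ℤ
sumℤ {zero} f = ℤ.+ 0
sumℤ {suc r} f = f fz ℤ.+ sumℤ (λ i → f (fs i))

ι-sum : ∀ {r} (g : Fin r → ℤ) → ι (sumℤ g) ≡ sumℚ (λ i → ι (g i))
ι-sum {zero} g = sym (ι-/1 0)
ι-sum {suc r} g = trans (ι-+ (g fz) _) (cong (ι (g fz) ℚ.+_) (ι-sum (λ i → g (fs i))))

sumℚ-*ʳ : ∀ {r} (f : Fin r → ℚ) x → sumℚ f ℚ.* x ≡ sumℚ (λ i → f i ℚ.* x)
sumℚ-*ʳ {zero} f x = ℚP.*-zeroˡ x
sumℚ-*ʳ {suc r} f x = trans (ℚP.*-distribʳ-+ x (f fz) _) (cong (f fz ℚ.* x ℚ.+_) (sumℚ-*ʳ (λ i → f (fs i)) x))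

sumℚ-cong : ∀ {r} (f g : Fin r → ℚ) → (∀ i → f i ≡ g i) → sumℚ f ≡ sumℚ g
sumℚ-cong {zero} f g h = refl
sumℚ-cong {suc r} f g h = cong₂ ℚ._+_ (h fz) (sumℚ-cong (λ i → f (fs i)) (λ i → g (fs i)) (λ i → h (fs i)))

-- A rational dependency Σ c_i v_i = 0 becomes an integral one Σ n_i v_i = 0,
-- n_i = c_i·∏_j den(c_j), with n_i ≠ 0 whenever c_i ≠ 0.
module IntegralDependency {r ℓ : ℕ} (c : Fin r → ℚ) (v : Fin r → Fin ℓ → ℕ)
  (dependent : ∀ a → sumℚ (λ i → c i ℚ.* ((ℤ.+ v i a) ℚ./ 1)) ≡ 0ℚ) where

  den : Fin r → ℕ
  den i = ↧ₙ c i

  den≥1 : ∀ i → 1 ≤ den i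
  den≥1 i with c i
  ... | mkℚ _ _ _ = s≤s z≤n

  cofactor : Fin r → ℕ
  cofactor i = proj₁ (product-factor den den≥1 i)

  n : Fin r → ℤ
  n i = ↥ (c i) ℤ.* ℤ.+ cofactor i

  n-dependent : ∀ a → sumℤ (λ i → n i ℤ.* ℤ.+ v i a) ≡ ℤ.+ 0
  n-dependent a = ι-injective _ _ (begin
    ι (sumℤ (λ i → n i ℤ.* ℤ.+ v i a))                     ≡⟨ ι-sum (λ i → n i ℤ.* ℤ.+ v i a) ⟩
    sumℚ (λ i → ι (n i ℤ.* ℤ.+ v i a))                     ≡⟨ sumℚ-cong _ _ term ⟩
    sumℚ (λ i → (c i ℚ.* ((ℤ.+ v i a) ℚ./ 1)) ℚ.* ι (ℤ.+ L)) ≡⟨ sym (sumℚ-*ʳ (λ i → c i ℚ.* ((ℤ.+ v i a) ℚ./ 1)) (ι (ℤ.+ L))) ⟩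
    sumℚ (λ i → c i ℚ.* ((ℤ.+ v i a) ℚ./ 1)) ℚ.* ι (ℤ.+ L) ≡⟨ cong (ℚ._* ι (ℤ.+ L)) (dependent a) ⟩
    0ℚ ℚ.* ι (ℤ.+ L)                                       ≡⟨ ℚP.*-zeroˡ (ι (ℤ.+ L)) ⟩
    ι (ℤ.+ 0)                                              ∎)
    where
    open ≡-Reasoning
    L = product den
    term : ∀ i → ι (n i ℤ.* ℤ.+ v i a) ≡ (c i ℚ.* ((ℤ.+ v i a) ℚ./ 1)) ℚ.* ι (ℤ.+ L)
    term i = begin
      ι (n i ℤ.* ℤ.+ v i a)                           ≡⟨ ι-* (n i) (ℤ.+ v i a) ⟩
      ι (n i) ℚ.* ι (ℤ.+ v i a)                       ≡⟨ cong (ℚ._* ι (ℤ.+ v i a)) (sym (clear-denominator (c i) (cofactor i))) ⟩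
      (c i ℚ.* ι (ℤ.+ (den i * cofactor i))) ℚ.* ι (ℤ.+ v i a)
        ≡⟨ cong (λ z → (c i ℚ.* ι (ℤ.+ z)) ℚ.* ι (ℤ.+ v i a)) (sym (proj₂ (proj₂ (product-factor den den≥1 i)))) ⟩
      (c i ℚ.* ι (ℤ.+ L)) ℚ.* ι (ℤ.+ v i a)           ≡⟨ ℚP.*-assoc (c i) _ _ ⟩
      c i ℚ.* (ι (ℤ.+ L) ℚ.* ι (ℤ.+ v i a))           ≡⟨ cong (c i ℚ.*_) (ℚP.*-comm (ι (ℤ.+ L)) (ι (ℤ.+ v i a))) ⟩
      c i ℚ.* (ι (ℤ.+ v i a) ℚ.* ι (ℤ.+ L))           ≡⟨ sym (ℚP.*-assoc (c i) _ _) ⟩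
      (c i ℚ.* ι (ℤ.+ v i a)) ℚ.* ι (ℤ.+ L)           ≡⟨ cong (λ z → (c i ℚ.* z) ℚ.* ι (ℤ.+ L)) (sym (ι-/1 (v i a))) ⟩
      (c i ℚ.* ((ℤ.+ v i a) ℚ./ 1)) ℚ.* ι (ℤ.+ L)     ∎

  n-nonzero : ∀ i → ¬ c i ≡ 0ℚ → ¬ n i ≡ ℤ.+ 0
  n-nonzero i c≢0 n≡0 with ℤP.i*j≡0⇒i≡0∨j≡0 (↥ (c i)) n≡0
  ... | inj₁ ↥c≡0 = c≢0 (ℚP.↥p≡0⇒p≡0 (c i) ↥c≡0)
  ... | inj₂ L≡0 = <-irrefl (sym (ℤP.+-injective L≡0)) (proj₁ (proj₂ (product-factor den den≥1 i)))

_⁺ : ℤ → ℕ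
(ℤ.+ n) ⁺ = n
ℤ.-[1+ n ] ⁺ = 0

_⁻ : ℤ → ℕ
(ℤ.+ n) ⁻ = 0
ℤ.-[1+ n ] ⁻ = suc n

parts : ∀ z x → ℤ.+ (z ⁺ * x) ≡ z ℤ.* ℤ.+ x ℤ.+ ℤ.+ (z ⁻ * x)
parts (ℤ.+ n) x = trans (ℤP.pos-* n x) (sym (ℤP.+-identityʳ _))
parts ℤ.-[1+ n ] x = sym (begin
  ℤ.-[1+ n ] ℤ.* ℤ.+ x ℤ.+ ℤ.+ (suc n * x)
    ≡⟨ cong (ℤ._+ ℤ.+ (suc n * x)) (sym (ℤP.neg-distribˡ-* (ℤ.+ suc n) (ℤ.+ x))) ⟩
  ℤ.- (ℤ.+ suc n ℤ.* ℤ.+ x) ℤ.+ ℤ.+ (suc n * x)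
    ≡⟨ cong (λ z → ℤ.- z ℤ.+ ℤ.+ (suc n * x)) (sym (ℤP.pos-* (suc n) x)) ⟩
  ℤ.- (ℤ.+ (suc n * x)) ℤ.+ ℤ.+ (suc n * x)
    ≡⟨ ℤP.+-inverseˡ (ℤ.+ (suc n * x)) ⟩
  ℤ.+ 0 ∎)
  where open ≡-Reasoning

sum-parts : ∀ {r} (g : Fin r → ℤ) (x : Fin r → ℕ) →
  ℤ.+ sumℕ (λ i → g i ⁺ * x i) ≡ sumℤ (λ i → g i ℤ.* ℤ.+ x i) ℤ.+ ℤ.+ sumℕ (λ i → g i ⁻ * x i)
sum-parts {zero} g x = refl
sum-parts {suc r} g x = begin
  ℤ.+ (g fz ⁺ * x fz + P)                   ≡⟨ ℤP.pos-+ (g fz ⁺ * x fz) P ⟩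
  ℤ.+ (g fz ⁺ * x fz) ℤ.+ ℤ.+ P             ≡⟨ cong₂ ℤ._+_ (parts (g fz) (x fz)) (sum-parts (λ i → g (fs i)) (λ i → x (fs i))) ⟩
  (u ℤ.+ ℤ.+ nu) ℤ.+ (S ℤ.+ ℤ.+ N)          ≡⟨ rearrange u (ℤ.+ nu) S (ℤ.+ N) ⟩
  (u ℤ.+ S) ℤ.+ (ℤ.+ nu ℤ.+ ℤ.+ N)          ≡⟨ cong (λ w → (u ℤ.+ S) ℤ.+ w) (sym (ℤP.pos-+ nu N)) ⟩
  (u ℤ.+ S) ℤ.+ ℤ.+ (nu + N)                ∎
  where
  open ≡-Reasoning
  P = sumℕ (λ i → g (fs i) ⁺ * x (fs i))
  N = sumℕ (λ i → g (fs i) ⁻ * x (fs i))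
  S = sumℤ (λ i → g (fs i) ℤ.* ℤ.+ x (fs i))
  u = g fz ℤ.* ℤ.+ x fz
  nu = g fz ⁻ * x fz
  rearrange : ∀ a b c d → (a ℤ.+ b) ℤ.+ (c ℤ.+ d) ≡ (a ℤ.+ c) ℤ.+ (b ℤ.+ d)
  rearrange = ℤSolver.solve-∀

-- An integral dependency Σ n_i v_i = 0 with n_0 ≠ 0 expresses a nonzero v_0
-- through v_1, …, v_k: move the terms of each sign to one side.
dependency⇒expressible : ∀ {k ℓ} (n : Fin (suc k) → ℤ) (v : Fin (suc k) → Fin ℓ → ℕ) →
  (∀ a → sumℤ (λ i → n i ℤ.* ℤ.+ v i a) ≡ ℤ.+ 0) → ¬ n fz ≡ ℤ.+ 0 →
  Σ (Fin ℓ) (λ a → 1 ≤ v fz a) → Expressible (v fz) (λ i → v (fs i))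
dependency⇒expressible n v dep n₀≢0 (a₀ , pos) = by-sign (n fz) refl
  where
  P N : Fin _ → ℕ
  P a = sumℕ (λ i → n (fs i) ⁺ * v (fs i) a)
  N a = sumℕ (λ i → n (fs i) ⁻ * v (fs i) a)
  signs : ∀ a → n fz ⁺ * v fz a + P a ≡ n fz ⁻ * v fz a + N a
  signs a = ℤP.+-injective (trans (sum-parts n (λ i → v i a))
                            (cong (ℤ._+ ℤ.+ sumℕ (λ i → n i ⁻ * v i a)) (dep a)))
  nonzero : ∀ {A : Set} → (∀ a → v fz a ≡ 0) → A
  nonzero v₀≡0 = ⊥-elim (<-irrefl (sym (v₀≡0 a₀)) pos)
  by-sign : ∀ z → n fz ≡ z → Expressible (v fz) (λ i → v (fs i))
  by-sign z n₀≡z with subst (λ w → ∀ a → w ⁺ * v fz a + P a ≡ w ⁻ * v fz a + N a) n₀≡z signs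
  by-sign (ℤ.+ zero) n₀≡0 | _ = ⊥-elim (n₀≢0 n₀≡0)
  by-sign (ℤ.+ suc d) _ | signs′ = suc d , s≤s z≤n , record
    { plus = λ i → n (fs i) ⁻ ; minus = λ i → n (fs i) ⁺ ; balanced = signs′ ; vanishes = nonzero }
  by-sign ℤ.-[1+ d ] _ | signs′ = suc d , s≤s z≤n , record
    { plus = λ i → n (fs i) ⁺ ; minus = λ i → n (fs i) ⁻ ; balanced = λ a → sym (signs′ a) ; vanishes = nonzero }

independent-extension : ∀ {k ℓ} (v : Fin (suc k) → Fin ℓ → ℕ) → LinIndep (λ i → v (fs i)) →
  Σ (Fin ℓ) (λ a → 1 ≤ v fz a) → ¬ Expressible (v fz) (λ i → v (fs i)) → LinIndep v
independent-extension v indep pos not-expressible c dep i with c i ℚ.≟ 0ℚ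
... | yes cᵢ≡0 = cᵢ≡0
... | no cᵢ≢0 with c fz ℚ.≟ 0ℚ
...   | no c₀≢0 = ⊥-elim (not-expressible (dependency⇒expressible n v n-dependent (n-nonzero fz c₀≢0) pos))
  where open IntegralDependency c v dep
...   | yes c₀≡0 = ⊥-elim (cᵢ≢0 (all-zero i))
  where
  rest-dependent : ∀ a → sumℚ (λ i → c (fs i) ℚ.* ((ℤ.+ v (fs i) a) ℚ./ 1)) ≡ 0ℚ
  rest-dependent a = begin
    sumℚ (λ i → c (fs i) ℚ.* ((ℤ.+ v (fs i) a) ℚ./ 1))
      ≡⟨ sym (ℚP.+-identityˡ _) ⟩
    0ℚ ℚ.+ sumℚ (λ i → c (fs i) ℚ.* ((ℤ.+ v (fs i) a) ℚ./ 1))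
      ≡⟨ cong (ℚ._+ rest) (sym (trans (cong (ℚ._* ((ℤ.+ v fz a) ℚ./ 1)) c₀≡0) (ℚP.*-zeroˡ ((ℤ.+ v fz a) ℚ./ 1)))) ⟩
    c fz ℚ.* ((ℤ.+ v fz a) ℚ./ 1) ℚ.+ sumℚ (λ i → c (fs i) ℚ.* ((ℤ.+ v (fs i) a) ℚ./ 1))
      ≡⟨ dep a ⟩
    0ℚ ∎
    where
    open ≡-Reasoning
    rest = sumℚ (λ i → c (fs i) ℚ.* ((ℤ.+ v (fs i) a) ℚ./ 1))
  all-zero : ∀ i → c i ≡ 0ℚ
  all-zero fz = c₀≡0
  all-zero (fs i) = indep (λ i → c (fs i)) rest-dependent i

¬¬-all : ∀ {m} {P : Fin m → Set} → (∀ j → ¬ ¬ P j) → ¬ ¬ (∀ j → P j)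
¬¬-all {zero} h k = k (λ ())
¬¬-all {suc m} {P} h k =
  h fz (λ p₀ → ¬¬-all {m} {λ j → P (fs j)} (λ j → h (fs j)) (λ ps → k (λ { fz → p₀ ; (fs j) → ps j })))

zero-expressible : ∀ {ℓ k} (x : Fin ℓ → ℕ) (b : Fin k → Fin ℓ → ℕ) → (∀ a → x a ≡ 0) → Expressible x b
zero-expressible x b x≡0 = 1 , s≤s z≤n , record
  { plus = λ _ → 0 ; minus = λ _ → 0 ; vanishes = λ _ _ → refl , refl
  ; balanced = λ a → cong (λ z → 1 * z + sumℕ (λ i → 0 * b i a)) (x≡0 a) }

-- A nonzero member b_{i₀} of the family is expressible, via the unit vector e_{i₀}.
member-expressible : ∀ {ℓ k} (b : Fin k → Fin ℓ → ℕ) (i₀ : Fin k) →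
  Σ (Fin ℓ) (λ a → 1 ≤ b i₀ a) → Expressible (b i₀) b
member-expressible {k = k} b i₀ (a₀ , pos) = 1 , s≤s z≤n , record
  { plus = e ; minus = λ _ → 0
  ; vanishes = λ b≡0 → ⊥-elim (<-irrefl (sym (b≡0 a₀)) pos)
  ; balanced = λ a → trans (cong (1 * b i₀ a +_) (sum-zero (λ i → 0 * b i a) (λ _ → refl)))
                           (trans (+-identityʳ (1 * b i₀ a)) (sym (e-sum a))) }
  where
  e : Fin k → ℕ
  e i = ind ⌊ i ≟F i₀ ⌋
  e-sum : ∀ a → sumℕ (λ i → e i * b i a) ≡ 1 * b i₀ a
  e-sum a = trans (sum-single _ i₀ (λ i i≢i₀ → cong (λ z → ind z * b i a) (⌊⌋-false (i ≟F i₀) i≢i₀)))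
                  (cong (λ z → ind z * b i₀ a) (⌊⌋-true (i₀ ≟F i₀) refl))

-- Then every period is (classically) expressible through the b_i: otherwise
-- it would extend s to k+1 independent periods.
period-expressible : ∀ {ℓ m k} (p : Fin m → Fin ℓ → ℕ) (s : Fin k → Fin m) →
  InjectiveFin s → LinIndep (λ i → p (s i)) →
  (∀ (t : Fin (suc k) → Fin m) → InjectiveFin t → ¬ LinIndep (λ i → p (t i))) →
  ∀ j → ¬ ¬ Expressible (p j) (λ i → p (s i))
period-expressible {k = k} p s s-inj indep maximal j not-expressible
  with any? (λ a → 1 ≤? p j a)
... | no no-positive =
  not-expressible (zero-expressible (p j) _ (λ a → n≤0⇒n≡0 (≮⇒≥ (λ pos → no-positive (a , pos)))))
... | yes positive with any? (λ i → s i ≟F j)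
...   | yes (i₀ , sᵢ₀≡j) = not-expressible
  (subst (λ z → Expressible (p z) (λ i → p (s i))) sᵢ₀≡j
     (member-expressible (λ i → p (s i)) i₀ (subst (λ z → Σ (Fin _) (λ a → 1 ≤ p z a)) (sym sᵢ₀≡j) positive)))
...   | no j∉s = maximal t t-inj (independent-extension (λ i → p (t i)) indep positive not-expressible)
  where
  t : Fin (suc k) → Fin _
  t fz = j
  t (fs i) = s i
  t-inj : InjectiveFin t
  t-inj fz fz _ = refl
  t-inj fz (fs y) e = ⊥-elim (j∉s (y , sym e))
  t-inj (fs x) fz e = ⊥-elim (j∉s (x , e))
  t-inj (fs x) (fs y) e = cong fs (s-inj x y e)

funToFin-cong : ∀ {n S} (v w : Fin n → Fin S) → (∀ i → v i ≡ w i) → funToFin v ≡ funToFin w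
funToFin-cong {zero} v w h = refl
funToFin-cong {suc n} v w h = cong₂ Fin.combine (h fz) (funToFin-cong (λ i → v (fs i)) (λ i → w (fs i)) (λ i → h (fs i)))

count-injection : ∀ {T S} n m (F : (Fin n → Fin T) → (Fin m → Fin S)) →
  (∀ t t′ → (∀ i → F t i ≡ F t′ i) → ∀ i → t i ≡ t′ i) → T ^ n ≤ S ^ m
count-injection {T} {S} n m F F-inj = injective⇒≤ code-injective
  where
  decode : Fin (T ^ n) → Fin n → Fin T
  decode = finToFun
  encode : (Fin n → Fin T) → Fin (T ^ n)
  encode = funToFin
  code : Fin (T ^ n) → Fin (S ^ m)
  code x = funToFin (F (decode x))
  decode-equal : ∀ x y → code x ≡ code y → ∀ i → F (decode x) i ≡ F (decode y) i
  decode-equal x y e i = begin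
    F (decode x) i         ≡⟨ sym (finToFun-funToFin (F (decode x)) i) ⟩
    finToFun (code x) i    ≡⟨ cong (λ z → finToFun z i) e ⟩
    finToFun (code y) i    ≡⟨ finToFun-funToFin (F (decode y)) i ⟩
    F (decode y) i         ∎
    where open ≡-Reasoning
  code-injective : ∀ {x y} → code x ≡ code y → x ≡ y
  code-injective {x} {y} e = begin
    x                   ≡⟨ sym (funToFin-finToFin {n} {T} x) ⟩
    encode (decode x)   ≡⟨ funToFin-cong _ _ (F-inj _ _ (decode-equal x y e)) ⟩
    encode (decode y)   ≡⟨ funToFin-finToFin {n} {T} y ⟩
    y                   ∎
    where open ≡-Reasoning

*-^ : ∀ a b k → (a * b) ^ k ≡ a ^ k * b ^ k
*-^ a b zero = refl
*-^ a b (suc k) = trans (cong ((a * b) *_) (*-^ a b k)) (interchange a b (a ^ k) (b ^ k))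
  where
  interchange : ∀ a b x y → a * b * (x * y) ≡ a * x * (b * y)
  interchange = solve-∀

box-too-small : ∀ C k → ¬ (suc (C ^ k) ^ suc k ≤ (C * suc (C ^ k)) ^ k)
box-too-small C k fits = n≮n (C ^ k) T≤Cᵏ
  where
  T = suc (C ^ k)
  T≤Cᵏ : T ≤ C ^ k
  T≤Cᵏ = *-cancelʳ-≤ T (C ^ k) (T ^ k) {{ℕ.>-nonZero (m^n>0 T k)}}
           (≤-trans fits (≤-reflexive (*-^ C T k)))

regroup : ∀ {m k} (c : Fin m → ℕ) (N : Fin m → Fin k → ℕ) (b : Fin k → ℕ) →
  sumℕ (λ i → sumℕ (λ j → c j * N j i) * b i) ≡ sumℕ (λ j → c j * sumℕ (λ i → N j i * b i))
regroup c N b = begin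
  sumℕ (λ i → sumℕ (λ j → c j * N j i) * b i)   ≡⟨ sum-cong _ _ (λ i → trans (*-comm _ (b i)) (sum-*ˡ (b i) (λ j → c j * N j i))) ⟩
  sumℕ (λ i → sumℕ (λ j → b i * (c j * N j i))) ≡⟨ sum-swap (λ i j → b i * (c j * N j i)) ⟩
  sumℕ (λ j → sumℕ (λ i → b i * (c j * N j i))) ≡⟨ sum-cong _ _ (λ j → trans (sum-cong _ _ (λ i → shuffle (b i) (c j) (N j i))) (sym (sum-*ˡ (c j) (λ i → N j i * b i)))) ⟩
  sumℕ (λ j → c j * sumℕ (λ i → N j i * b i))   ∎
  where
  open ≡-Reasoning
  shuffle : ∀ x y z → x * (y * z) ≡ y * (z * x)
  shuffle = solve-∀

combine-relations : ∀ {ℓ m k D} (x : Fin m → Fin ℓ → ℕ) (b : Fin k → Fin ℓ → ℕ) →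
  (rel : ∀ j → Relation D (x j) b) → (c : Fin m → ℕ) → ∀ a →
  D * sumℕ (λ j → c j * x j a) + sumℕ (λ i → sumℕ (λ j → c j * Relation.minus (rel j) i) * b i a)
    ≡ sumℕ (λ i → sumℕ (λ j → c j * Relation.plus (rel j) i) * b i a)
combine-relations {D = D} x b rel c a = begin
  D * sumℕ (λ j → c j * x j a) + sumℕ (λ i → sumℕ (λ j → c j * minus j i) * b i a)
    ≡⟨ cong₂ _+_ (trans (sum-*ˡ D (λ j → c j * x j a)) (sum-cong _ _ (λ j → swap D (c j) (x j a)))) (regroup c minus (λ i → b i a)) ⟩
  sumℕ (λ j → c j * (D * x j a)) + sumℕ (λ j → c j * sumℕ (λ i → minus j i * b i a))
    ≡⟨ sym (sum-+ (λ j → c j * (D * x j a)) (λ j → c j * sumℕ (λ i → minus j i * b i a))) ⟩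
  sumℕ (λ j → c j * (D * x j a) + c j * sumℕ (λ i → minus j i * b i a))
    ≡⟨ sum-cong _ _ (λ j → trans (sym (*-distribˡ-+ (c j) _ _)) (cong (c j *_) (Relation.balanced (rel j) a))) ⟩
  sumℕ (λ j → c j * sumℕ (λ i → plus j i * b i a))
    ≡⟨ sym (regroup c plus (λ i → b i a)) ⟩
  sumℕ (λ i → sumℕ (λ j → c j * plus j i) * b i a) ∎
  where
  open ≡-Reasoning
  plus minus : Fin _ → Fin _ → ℕ
  plus j = Relation.plus (rel j)
  minus j = Relation.minus (rel j)
  swap : ∀ x y z → x * (y * z) ≡ y * (x * z)
  swap = solve-∀

cancel-∸ : ∀ B a a′ n n′ → n ≤ B → n′ ≤ B → a + (B ∸ n) ≡ a′ + (B ∸ n′) → a + n′ ≡ a′ + n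
cancel-∸ B a a′ n n′ n≤B n′≤B e = +-cancelʳ-≡ B _ _ (begin
  a + n′ + B                  ≡⟨ cong (a + n′ +_) (sym (m∸n+n≡m n≤B)) ⟩
  a + n′ + (B ∸ n + n)        ≡⟨ shuffle₁ a n′ (B ∸ n) n ⟩
  (a + (B ∸ n)) + (n + n′)    ≡⟨ cong (_+ (n + n′)) e ⟩
  (a′ + (B ∸ n′)) + (n + n′)  ≡⟨ shuffle₂ a′ (B ∸ n′) n n′ ⟩
  a′ + n + (B ∸ n′ + n′)      ≡⟨ cong (a′ + n +_) (m∸n+n≡m n′≤B) ⟩
  a′ + n + B                  ∎)
  where
  open ≡-Reasoning
  shuffle₁ : ∀ a n′ x n → a + n′ + (x + n) ≡ (a + x) + (n + n′)
  shuffle₁ = solve-∀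
  shuffle₂ : ∀ a′ x n n′ → (a′ + x) + (n + n′) ≡ a′ + n + (x + n′)
  shuffle₂ = solve-∀

module PumpingArgument {ℓ m k : ℕ} (lam : ℕ) (lam≥1 : 1 ≤ lam)
  (p0 : Fin ℓ → ℕ) (p : Fin m → Fin ℓ → ℕ) (s : Fin k → Fin m)
  (D : ℕ) (D≥1 : 1 ≤ D) (rel : ∀ j → Relation D (p j) (λ i → p (s i)))
  (A : DFA ℓ) (recognises : ∀ v → fImage lam p0 p v ⇔ (accepts A v ≡ true))
  (w : Word ℓ) (w∈L : fImage lam p0 p w)
  (jj : Fin (suc k) → Fin ℓ) (jj-inj : InjectiveFin jj)
  (long : ∀ i → DFA.nStates A ≤ Ψ w (jj i)) where

  Q = DFA.nStates A

  b : Fin k → Fin ℓ → ℕ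
  b i = p (s i)

  plus minus : Fin m → Fin k → ℕ
  plus j = Relation.plus (rel j)
  minus j = Relation.minus (rel j)

  -- The pumped word v_t: t_i extra blocks of Q! letters a_{jj i}.
  bump : (Fin (suc k) → ℕ) → Fin ℓ → ℕ
  bump t a = sumℕ (λ i → ind (jj i ≡ᶠ a) * t i)

  bump-at : ∀ t i → bump t (jj i) ≡ t i
  bump-at t i = begin
    sumℕ (λ i′ → ind (jj i′ ≡ᶠ jj i) * t i′) ≡⟨ sum-single _ i (λ i′ i′≢i → cong (λ z → ind z * t i′) (≢ᶠ (jj i′) (jj i) (λ e → i′≢i (jj-inj i′ i e)))) ⟩
    ind (jj i ≡ᶠ jj i) * t i                 ≡⟨ cong (λ z → ind z * t i) (≡ᶠ-refl (jj i)) ⟩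
    t i + 0                                  ≡⟨ +-identityʳ (t i) ⟩
    t i                                      ∎
    where open ≡-Reasoning

  pumpedΨ : (Fin (suc k) → ℕ) → Fin ℓ → ℕ
  pumpedΨ t a = Ψ w a + bump t a * Q !

  pumped : (Fin (suc k) → ℕ) → Word ℓ
  pumped t = word (pumpedΨ t)

  pumping : ∀ t → Pumping Q (Ψ w) (pumpedΨ t)
  pumping t a with any? (λ i → jj i ≟F a)
  ... | yes (i , jjᵢ≡a) = inj₂ (subst (λ z → Q ≤ Ψ w z) jjᵢ≡a (long i) , bump t a , refl)
  ... | no unpumped = inj₁ (trans (cong (λ z → Ψ w a + z * Q !) (sum-zero _ not-here)) (+-identityʳ (Ψ w a)))
    where
    not-here : ∀ i → ind (jj i ≡ᶠ a) * t i ≡ 0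
    not-here i = cong (λ z → ind z * t i) (≢ᶠ (jj i) a (λ e → unpumped (i , e)))

  pumped∈L : ∀ t → fImage lam p0 p (pumped t)
  pumped∈L t = Equivalence.from (recognises (pumped t)) (begin
    DFA.final A (foldl (DFA.δ A) (DFA.start A) (pumped t))
      ≡⟨ cong (DFA.final A) (run-pumped Q (DFA.δ A) (Ψ w) (pumpedΨ t) (pumping t) (allFin ℓ) (DFA.start A)) ⟩
    DFA.final A (foldl (DFA.δ A) (DFA.start A) (word (Ψ w)))
      ≡⟨ cong (λ v → DFA.final A (foldl (DFA.δ A) (DFA.start A) v)) (sym (sorted-word w (InB⇒Sorted w w-sorted))) ⟩
    accepts A w
      ≡⟨ Equivalence.to (recognises w) w∈L ⟩
    true ∎)
    where
    open ≡-Reasoning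
    w-sorted : InB w
    w-sorted = proj₁ (proj₂ (proj₂ w∈L))

  u : (Fin (suc k) → ℕ) → Word ℓ
  u t = proj₁ (pumped∈L t)

  u∈B : ∀ t → InB (u t)
  u∈B t = proj₁ (proj₁ (proj₂ (pumped∈L t)))

  c : (Fin (suc k) → ℕ) → Fin m → ℕ
  c t = proj₁ (proj₂ (proj₁ (proj₂ (pumped∈L t))))

  Ψu : ∀ t a → Ψ (u t) a ≡ p0 a + sumℕ (λ j → c t j * p j a)
  Ψu t = proj₂ (proj₂ (proj₁ (proj₂ (pumped∈L t))))

  pumped∈B : ∀ t → InB (pumped t)
  pumped∈B t = proj₁ (proj₂ (proj₂ (pumped∈L t)))

  val-pumped : ∀ t → val (pumped t) ≡ lam * val (u t)
  val-pumped t = proj₂ (proj₂ (proj₂ (pumped∈L t)))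

  P N : (Fin (suc k) → ℕ) → Fin k → ℕ
  P t i = sumℕ (λ j → c t j * plus j i)
  N t i = sumℕ (λ j → c t j * minus j i)

  Sb : (Fin k → ℕ) → Fin ℓ → ℕ
  Sb f a = sumℕ (λ i → f i * b i a)

  Sb-+ : ∀ f g a → Sb (λ i → f i + g i) a ≡ Sb f a + Sb g a
  Sb-+ f g a = trans (sum-cong _ _ (λ i → *-distribʳ-+ (b i a) (f i) (g i))) (sum-+ (λ i → f i * b i a) (λ i → g i * b i a))

  coordinates : ∀ t a → D * Ψ (u t) a + Sb (N t) a ≡ D * p0 a + Sb (P t) a
  coordinates t a = begin
    D * Ψ (u t) a + Sb (N t) a                                ≡⟨ cong (λ z → D * z + Sb (N t) a) (Ψu t a) ⟩
    D * (p0 a + sumℕ (λ j → c t j * p j a)) + Sb (N t) a      ≡⟨ cong (_+ Sb (N t) a) (*-distribˡ-+ D (p0 a) _) ⟩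
    D * p0 a + D * sumℕ (λ j → c t j * p j a) + Sb (N t) a    ≡⟨ +-assoc (D * p0 a) _ _ ⟩
    D * p0 a + (D * sumℕ (λ j → c t j * p j a) + Sb (N t) a)  ≡⟨ cong (D * p0 a +_) (combine-relations p b rel (c t) a) ⟩
    D * p0 a + Sb (P t) a                                     ∎
    where open ≡-Reasoning

  |u|≤|pumped| : ∀ t → length (u t) ≤ length (pumped t)
  |u|≤|pumped| t = val-length (u t) (pumped t) (u∈B t) (pumped∈B t)
    (subst (val (u t) ≤_) (sym (val-pumped t)) (m≤n*m (val (u t)) lam {{ℕ.>-nonZero lam≥1}}))

  c≤R : ∀ t R → length (pumped t) ≤ R → ∀ j a → 1 ≤ p j a → c t j ≤ R
  c≤R t R short j a pos = begin
    c t j                             ≤⟨ m≤m*n (c t j) (p j a) {{ℕ.>-nonZero pos}} ⟩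
    c t j * p j a                     ≤⟨ term≤sum (λ j′ → c t j′ * p j′ a) j ⟩
    sumℕ (λ j′ → c t j′ * p j′ a)     ≤⟨ m≤n+m _ (p0 a) ⟩
    p0 a + sumℕ (λ j′ → c t j′ * p j′ a) ≡⟨ sym (Ψu t a) ⟩
    Ψ (u t) a                         ≤⟨ count≤length a (u t) ⟩
    length (u t)                      ≤⟨ |u|≤|pumped| t ⟩
    length (pumped t)                 ≤⟨ short ⟩
    R                                 ∎
    where open ≤-Reasoning

  K : ℕ
  K = sumℕ (λ i → sumℕ (λ j → plus j i + minus j i))

  coefficient-bound : ∀ t R → length (pumped t) ≤ R → (M : Fin m → Fin k → ℕ) →
    (∀ j i → M j i ≤ plus j i + minus j i) → (∀ j → (∀ a → p j a ≡ 0) → ∀ i → M j i ≡ 0) →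
    ∀ i → sumℕ (λ j → c t j * M j i) ≤ R * K
  coefficient-bound t R short M M≤ M-vanishes i = begin
    sumℕ (λ j → c t j * M j i)                   ≤⟨ sum-mono _ _ term ⟩
    sumℕ (λ j → R * M j i)                       ≡⟨ sym (sum-*ˡ R (λ j → M j i)) ⟩
    R * sumℕ (λ j → M j i)                       ≤⟨ *-monoʳ-≤ R (sum-mono _ _ (λ j → M≤ j i)) ⟩
    R * sumℕ (λ j → plus j i + minus j i)        ≤⟨ *-monoʳ-≤ R (term≤sum (λ i → sumℕ (λ j → plus j i + minus j i)) i) ⟩
    R * K                                        ∎
    where
    open ≤-Reasoning
    term : ∀ j → c t j * M j i ≤ R * M j i
    term j with any? (λ a → 1 ≤? p j a)
    ... | yes (a , pos) = *-monoˡ-≤ (M j i) (c≤R t R short j a pos)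
    ... | no no-positive = ≤-reflexive (trans (cong (c t j *_) Mᵢ≡0) (trans (*-zeroʳ (c t j)) (sym (trans (cong (R *_) Mᵢ≡0) (*-zeroʳ R)))))
      where
      Mᵢ≡0 : M j i ≡ 0
      Mᵢ≡0 = M-vanishes j (λ a → n≤0⇒n≡0 (≮⇒≥ (λ pos → no-positive (a , pos)))) i

  P≤ : ∀ t R → length (pumped t) ≤ R → ∀ i → P t i ≤ R * K
  P≤ t R short = coefficient-bound t R short plus (λ j i → m≤m+n _ _) (λ j z i → proj₁ (Relation.vanishes (rel j) z i))

  N≤ : ∀ t R → length (pumped t) ≤ R → ∀ i → N t i ≤ R * K
  N≤ t R short = coefficient-bound t R short minus (λ j i → m≤n+m _ _) (λ j z i → proj₂ (Relation.vanishes (rel j) z i))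

  coordinates-determine-u : ∀ t t′ → (∀ i → N t i + P t′ i ≡ N t′ i + P t i) → u t ≡ u t′
  coordinates-determine-u t t′ cross = Ψ-injective (u t) (u t′) (InB⇒Sorted _ (u∈B t)) (InB⇒Sorted _ (u∈B t′)) same-Ψ
    where
    same-Ψ : ∀ a → Ψ (u t) a ≡ Ψ (u t′) a
    same-Ψ a = *-cancelˡ-≡ _ _ D {{ℕ.>-nonZero D≥1}} (+-cancelʳ-≡ Z _ _ (begin
      D * Ψ (u t) a + Z                               ≡⟨ cong (D * Ψ (u t) a +_) (Sb-+ (N t) (P t′) a) ⟩
      D * Ψ (u t) a + (Sb (N t) a + Sb (P t′) a)      ≡⟨ sym (+-assoc (D * Ψ (u t) a) _ _) ⟩
      D * Ψ (u t) a + Sb (N t) a + Sb (P t′) a        ≡⟨ cong (_+ Sb (P t′) a) (coordinates t a) ⟩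
      D * p0 a + Sb (P t) a + Sb (P t′) a             ≡⟨ swap₂ (D * p0 a) (Sb (P t) a) (Sb (P t′) a) ⟩
      D * p0 a + Sb (P t′) a + Sb (P t) a             ≡⟨ cong (_+ Sb (P t) a) (sym (coordinates t′ a)) ⟩
      D * Ψ (u t′) a + Sb (N t′) a + Sb (P t) a       ≡⟨ +-assoc (D * Ψ (u t′) a) _ _ ⟩
      D * Ψ (u t′) a + (Sb (N t′) a + Sb (P t) a)     ≡⟨ cong (D * Ψ (u t′) a +_) (sym (Sb-+ (N t′) (P t) a)) ⟩
      D * Ψ (u t′) a + Sb (λ i → N t′ i + P t i) a    ≡⟨ cong (D * Ψ (u t′) a +_) (sum-cong _ _ (λ i → cong (_* b i a) (sym (cross i)))) ⟩
      D * Ψ (u t′) a + Z                              ∎))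
      where
      open ≡-Reasoning
      Z = Sb (λ i → N t i + P t′ i) a
      swap₂ : ∀ x y z → x + y + z ≡ x + z + y
      swap₂ = solve-∀

  u-determines-t : ∀ t t′ → u t ≡ u t′ → ∀ i → t i ≡ t′ i
  u-determines-t t t′ same-u i = begin
    t i                      ≡⟨ sym (bump-at t i) ⟩
    bump t (jj i)            ≡⟨ *-cancelʳ-≡ _ _ (Q !) {{Q !≢0}} (+-cancelˡ-≡ (Ψ w (jj i)) _ _ same-Ψ) ⟩
    bump t′ (jj i)           ≡⟨ bump-at t′ i ⟩
    t′ i                     ∎
    where
    open ≡-Reasoning
    same-v : pumped t ≡ pumped t′
    same-v = val-injective (pumped t) (pumped t′) (pumped∈B t) (pumped∈B t′)
      (trans (val-pumped t) (trans (cong (λ v → lam * val v) same-u) (sym (val-pumped t′))))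
    same-Ψ : pumpedΨ t (jj i) ≡ pumpedΨ t′ (jj i)
    same-Ψ = trans (sym (Ψ-word (pumpedΨ t) (jj i))) (trans (cong (λ v → Ψ v (jj i)) same-v) (Ψ-word (pumpedΨ t′) (jj i)))

  -- Counting: t ∈ [0,T)^{k+1} gives |v_t| ≤ R = A0·T, and the code
  -- i ↦ P_i + (B − N_i) ∈ [0, 2B] with B = R·K is injective.
  A0 C T R B : ℕ
  A0 = sumℕ (Ψ w) + ℓ * (suc k * Q !)
  C = suc (A0 * K + A0 * K)
  T = suc (C ^ k)
  R = A0 * T
  B = R * K

  toℕs : (Fin (suc k) → Fin T) → Fin (suc k) → ℕ
  toℕs t i = toℕ (t i)

  pumped-short : ∀ t → length (pumped (toℕs t)) ≤ R
  pumped-short t = begin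
    length (pumped (toℕs t))                                  ≡⟨ length-word (pumpedΨ (toℕs t)) ⟩
    sumℕ (pumpedΨ (toℕs t))                                   ≡⟨ sum-+ (Ψ w) (λ a → bump (toℕs t) a * Q !) ⟩
    sumℕ (Ψ w) + sumℕ (λ a → bump (toℕs t) a * Q !)           ≤⟨ +-monoʳ-≤ (sumℕ (Ψ w)) (sum-mono {ℓ} _ (λ _ → suc k * T * Q !) (λ a → *-monoˡ-≤ (Q !) (bump≤ a))) ⟩
    sumℕ (Ψ w) + sumℕ {ℓ} (λ _ → suc k * T * Q !)               ≡⟨ cong (sumℕ (Ψ w) +_) (sum-const ℓ (suc k * T * Q !)) ⟩
    sumℕ (Ψ w) + ℓ * (suc k * T * Q !)                        ≤⟨ +-monoˡ-≤ (ℓ * (suc k * T * Q !)) (m≤m*n (sumℕ (Ψ w)) T) ⟩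
    sumℕ (Ψ w) * T + ℓ * (suc k * T * Q !)                    ≡⟨ factor (sumℕ (Ψ w)) ℓ (suc k) T (Q !) ⟩
    R                                                         ∎
    where
    open ≤-Reasoning
    indicator≤ : ∀ z x → ind z * x ≤ x
    indicator≤ true x = ≤-reflexive (+-identityʳ x)
    indicator≤ false x = z≤n
    bump≤ : ∀ a → bump (toℕs t) a ≤ suc k * T
    bump≤ a = ≤-trans (sum-mono _ _ (λ i → ≤-trans (indicator≤ (jj i ≡ᶠ a) (toℕs t i)) (<⇒≤ (toℕ<n (t i)))))
                      (≤-reflexive (sum-const (suc k) T))
    factor : ∀ E l k′ t q → E * t + l * (k′ * t * q) ≡ (E + l * (k′ * q)) * t
    factor = solve-∀

  code : (Fin (suc k) → Fin T) → Fin k → Fin (suc (B + B))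
  code t i = fromℕ< (s≤s (+-mono-≤ (P≤ (toℕs t) R (pumped-short t) i) (m∸n≤m B (N (toℕs t) i))))

  code-injective : ∀ t t′ → (∀ i → code t i ≡ code t′ i) → ∀ i → t i ≡ t′ i
  code-injective t t′ same i = toℕ-injective (u-determines-t (toℕs t) (toℕs t′) (coordinates-determine-u _ _ cross) i)
    where
    N≤B : ∀ t → ∀ i → N (toℕs t) i ≤ B
    N≤B t = N≤ (toℕs t) R (pumped-short t)
    cross : ∀ i → N (toℕs t) i + P (toℕs t′) i ≡ N (toℕs t′) i + P (toℕs t) i
    cross i = trans (+-comm (N (toℕs t) i) _)
      (trans (sym (cancel-∸ B (P (toℕs t) i) (P (toℕs t′) i) (N (toℕs t) i) (N (toℕs t′) i) (N≤B t i) (N≤B t′ i)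
                (trans (sym (toℕ-fromℕ< _)) (trans (cong toℕ (same i)) (toℕ-fromℕ< _)))))
        (+-comm (P (toℕs t) i) _))

  impossible : ⊥
  impossible = box-too-small C k (begin
    T ^ suc k            ≤⟨ count-injection (suc k) k code code-injective ⟩
    suc (B + B) ^ k      ≤⟨ ^-monoˡ-≤ k (+-mono-≤ (s≤s z≤n) (≤-reflexive (box-side A0 K T))) ⟩
    (C * T) ^ k          ∎)
    where
    open ≤-Reasoning
    box-side : ∀ a κ t → a * t * κ + a * t * κ ≡ (a * κ + a * κ) * t
    box-side = solve-∀

increasing⇒injective : ∀ {n ℓ} (f : Fin n → Fin ℓ) → (∀ a b → a <F b → f a <F f b) → InjectiveFin f
increasing⇒injective f increasing a b fa≡fb with <-cmp (toℕ a) (toℕ b)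
... | tri< a<b _ _ = ⊥-elim (<-irrefl (cong toℕ fa≡fb) (increasing a b a<b))
... | tri≈ _ a≡b _ = toℕ-injective a≡b
... | tri> _ _ b<a = ⊥-elim (<-irrefl (cong toℕ (sym fa≡fb)) (increasing b a b<a))

-- Lemma 28.  Given a DFA for f_{β^ℓ}(B): the periods are expressible through
-- k independent ones (classically, fine since the goal is ⊥), a common
-- denominator exists, the sequence x supplies a word with k+1 long letter
-- blocks, and the pumping argument yields ⊥.
lemma28 : (ℓ β k m : ℕ) → 1 ≤ ℓ → 1 ≤ β → k < ℓ →
    (p0 : Fin ℓ → ℕ) (p : Fin m → Fin ℓ → ℕ) → Rank p k →
    (x : ℕ → Fin ℓ → ℕ) →
    (∀ n → Σ (Word ℓ) λ w → fImage (β ^ ℓ) p0 p w × (∀ j → Ψ w j ≡ x n j)) →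
    (jj : Fin (suc k) → Fin ℓ) → (∀ a b → a <F b → jj a <F jj b) →
    (∀ M → Σ ℕ λ N → ∀ n → N ≤ n → ∀ i → M ≤ x n (jj i)) →
    ¬ Regular (fImage (β ^ ℓ) p0 p)
lemma28 ℓ β k m _ β≥1 _ p0 p ((s , s-inj , indep) , maximal) x realised jj increasing unbounded (A , recognises) =
  ¬¬-all (period-expressible p s s-inj indep maximal) (λ expressible →
    conclude (common-denominator p (λ i → p (s i)) expressible))
  where
  Q = DFA.nStates A
  n₀ = proj₁ (unbounded Q)
  w = proj₁ (realised n₀)
  long : ∀ i → Q ≤ Ψ w (jj i)
  long i = subst (Q ≤_) (sym (proj₂ (proj₂ (realised n₀)) (jj i))) (proj₂ (unbounded Q) n₀ ≤-refl i)
  conclude : Σ ℕ (λ D → 1 ≤ D × (∀ j → Relation D (p j) (λ i → p (s i)))) → ⊥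
  conclude (D , D≥1 , rel) =
    PumpingArgument.impossible (β ^ ℓ) (m^n>0 β {{ℕ.>-nonZero β≥1}} ℓ) p0 p s D D≥1 rel A recognises
      w (proj₁ (proj₂ (realised n₀))) jj (increasing⇒injective jj increasing) long
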